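{- Let $n\geq 3$, let $M_0$ be a simple matroid on a ground set $E_0$ disjoint from $[n]$, fix $\epsilon_0\in E_0$, and let $M=C_n\oplus M_0$ on $E=[n]\cup E_0$ and $M'=P^n_{\epsilon_0}\oplus S$ on $\bar E\cup\{p\}$. Let $\hat\phi:\Lambda(E)\to\Lambda(\bar E\cup\{p\})$ be the algebra homomorphism with $\hat\phi(e_i)=\bar e_i-\bar e_n+e_p$ for $i\in[n-1]$, $\hat\phi(e_n)=e_p$, and $\hat\phi(e_\epsilon)=\bar e_\epsilon$ for $\epsilon\in E_0$. Then $\hat\phi$ induces a surjective graded algebra homomorphism $\phi:A(M)\to A(M')$.
   Context: For a finite set $E$, $\Lambda(E)$ is the exterior algebra over a fixed commutative ring $K$ generated by degree-one elements $e_i$, $i\in E$; $\partial$ is the $K$-linear map with $\partial(e_{i_1}\cdots e_{i_k})=\sum_{j=1}^k(-1)^{j-1}e_{i_1}\cdots\widehat{e_{i_j}}\cdots e_{i_k}$; for a simple matroid $N$ on $E$, $I(N)$ is the ideal generated by $\partial(e_{i_1}\cdots e_{i_k})$ over circuits $\{i_1,\dots,i_k\}$ of $N$, and the Orlik–Solomon algebra is $A(N)=\Lambda(E)/I(N)$. $C_n$ is the matroid on $[n]=\{1,\dots,n\}$ of rank $n-1$ whose only circuit is $[n]$; $S$ is the rank-one matroid on a single point $p$; $\oplus$ is direct sum. The parallel connection $P^n_{\epsilon_0}$: on $[n]\cup E_0$ identify $1$ with $\epsilon_0$ (other classes singletons), write $\bar q$ for the class of $q$, $\bar X$ for the set of classes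 of elements of $X$, $\bar E$ for the set of classes; $P^n_{\epsilon_0}$ is the matroid on $\bar E$ whose circuits are the $\bar C$ with $C$ a circuit of $C_n$ or of $M_0$, together with the sets $\overline{C-1}\cup\overline{C'-\epsilon_0}$ with $1\in C$ a circuit of $C_n$ and $\epsilon_0\in C'$ a circuit of $M_0$. The generator corresponding to $\bar\epsilon$ is written $\bar e_\epsilon$ (so $\bar e_1=\bar e_{\epsilon_0}$). -}

module Defs where

open import Level using (_⊔_)
open import Data.Nat using (ℕ; zero; suc; _+_; _≤_; s≤s)
open import Data.Bool using (Bool; true; false; if_then_else_; _∧_; not)
open import Data.Fin using (Fin; zero; suc; _↑ˡ_; _↑ʳ_; splitAt; fromℕ; _≟_)
open import Data.Fin.Subset using (Subset; _∈_; _⊆_; _∪_; ∣_∣; ⁅_⁆) renaming (⊥ to ∅; ⊤ to full; _-_ to _∖_)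
open import Data.Fin.Subset.Properties using () renaming (_∈?_ to _∈?ˢ_)
open import Data.Vec using (Vec; []; _∷_; _++_; lookup)
open import Data.Vec.Properties using (≡-dec)
open import Data.List using (List; []; _∷_; map; foldr) renaming (_++_ to _++ₗ_)
open import Data.List.Base using (allFin)
open import Data.Product using (Σ; ∃; _×_; _,_)
open import Data.Sum using (_⊎_; [_,_])
open import Data.Empty renaming (⊥ to Empty)
open import Relation.Nullary using (¬_; Dec; yes; no)
open import Relation.Nullary.Decidable using (⌊_⌋)
open import Relation.Binary.PropositionalEquality using (_≡_; _≢_)
open import Algebra.Bundles using (CommutativeRing)
import Data.Bool as B

-- Matroids on Fin m, given by their circuits (Oxley's circuit axioms).
-- Element i : Fin m is a point of the ground set; subsets are Subset m.

record SimpleMatroid (m : ℕ) : Set₁ where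
  field
    Circuit : Subset m → Set
    C1 : ¬ Circuit ∅
    C2 : ∀ {C D} → Circuit C → Circuit D → D ⊆ C → D ≡ C
    C3 : ∀ {C D e} → Circuit C → Circuit D → C ≢ D → e ∈ C → e ∈ D →
         ∃ λ F → Circuit F × F ⊆ ((C ∪ D) ∖ e)
    -- simple: no loops (circuits of size 1) and no parallel pairs (size 2)
    simple : ∀ {C} → Circuit C → 3 ≤ ∣ C ∣
open SimpleMatroid public

-- Ground-set conventions.
-- [n] is Fin n (index i stands for the element i+1); E0 is Fin m.
-- E = [n] ∪ E0 is Fin (n + m): i ↦ i ↑ˡ m , ε ↦ n ↑ʳ ε.
-- The target Ē ∪ {p} is also Fin (n + m):
--   slot (zero ↑ˡ m)       is p,
--   slot (suc i ↑ˡ m)      is the class of the element i+2 ∈ [n],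
--   slot (n ↑ʳ ε)          is the class of ε ∈ E0 (class of ε0 = class of 1).

oneN : ∀ {n} → 3 ≤ n → Fin n
oneN (s≤s _) = zero

lastN : ∀ {n} → 3 ≤ n → Fin n
lastN {suc k} _ = fromℕ k

pSlot : ∀ {n} m → 3 ≤ n → Fin (n + m)
pSlot m (s≤s _) = zero ↑ˡ m

clsN : ∀ {n m} → Fin m → Fin n → Fin (n + m)
clsN {n} ε0 zero    = n ↑ʳ ε0
clsN {m = m} ε0 (suc i) = suc i ↑ˡ m

cls0 : ∀ {n m} → Fin m → Fin (n + m)
cls0 {n} ε = n ↑ʳ ε

ImageOf : ∀ {a b} → (Fin a → Fin b) → (Fin a → Set) → Subset b → Set
ImageOf f P T = ∀ y → (y ∈ T → ∃ λ x → P x × f x ≡ y) × ((∃ λ x → P x × f x ≡ y) → y ∈ T)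

CnCirc : ∀ {n} → Subset n → Set
CnCirc C = C ≡ full

-- S : rank one matroid on a single point: no circuits
SCirc : Subset 1 → Set
SCirc _ = Empty

SumCirc : ∀ {a b} → (Subset a → Set) → (Subset b → Set) → Subset (a + b) → Set
SumCirc A B C = (∃ λ D → A D × C ≡ D ++ ∅) ⊎ (∃ λ D → B D × C ≡ ∅ ++ D)

MCirc : ∀ {n m} → SimpleMatroid m → Subset (n + m) → Set
MCirc M0 = SumCirc CnCirc (Circuit M0)

PCirc : ∀ {n m} → 3 ≤ n → SimpleMatroid m → Fin m → Subset (n + m) → Set
PCirc {n} {m} h M0 ε0 T =
    (∃ λ C → CnCirc C × ImageOf (clsN ε0) (_∈ C) T)
  ⊎ (∃ λ D → Circuit M0 D × ImageOf (cls0 {n}) (_∈ D) T)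
  ⊎ (∃ λ C → ∃ λ D → CnCirc C × oneN h ∈ C × Circuit M0 D × ε0 ∈ D ×
      (∀ y → (y ∈ T → Glue C D y) × (Glue C D y → y ∈ T)))
  where
  Glue : Subset n → Subset m → Fin (n + m) → Set
  Glue C D y = (∃ λ i → i ∈ C × i ≢ oneN h × clsN ε0 i ≡ y)
             ⊎ (∃ λ ε → ε ∈ D × ε ≢ ε0 × cls0 {n} ε ≡ y)

M'Circ : ∀ {n m} → 3 ≤ n → SimpleMatroid m → Fin m → Subset (n + m) → Set
M'Circ {n} {m} h M0 ε0 T =
  PCirc h M0 ε0 T ⊎ (∃ λ D → SCirc D × ImageOf (λ (_ : Fin 1) → pSlot m h) (_∈ D) T)

-- Exterior algebra Λ(Fin k) over a commutative ring K, as the free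
-- K-module on the subsets S ⊆ Fin k (S ↔ e_{i1}⋯e_{ir}, i1 < ⋯ < ir).

allSubsets : (k : ℕ) → List (Subset k)
allSubsets zero    = [] ∷ []
allSubsets (suc k) = map (true ∷_) (allSubsets k) ++ₗ map (false ∷_) (allSubsets k)

elems : ∀ {k} → Subset k → List (Fin k)
elems []            = []
elems (true  ∷ S) = zero ∷ map suc (elems S)
elems (false ∷ S) = map suc (elems S)

inv : ∀ {k} → Subset k → Subset k → ℕ
inv []      []      = 0
inv (s ∷ S) (t ∷ T) = (if t then ∣ S ∣ else 0) + inv S T

below : ∀ {k} → Fin k → Subset k → ℕ
below zero    _       = 0
below (suc i) (s ∷ S) = (if s then 1 else 0) + below i S

disjointᵇ : ∀ {k} → Subset k → Subset k → Bool
disjointᵇ []      []      = true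
disjointᵇ (s ∷ S) (t ∷ T) = not (s ∧ t) ∧ disjointᵇ S T

eqᵇ : ∀ {k} → Subset k → Subset k → Bool
eqᵇ S T = ⌊ ≡-dec B._≟_ S T ⌋

module Ext {c ℓ} (K : CommutativeRing c ℓ) where
  open CommutativeRing K hiding (_-_) renaming (Carrier to R; _+_ to _+ᴷ_; _*_ to _*ᴷ_; -_ to -ᴷ_)

  Λ : ℕ → Set c
  Λ k = Subset k → R

  ΣL : ∀ {a} {A : Set a} → List A → (A → R) → R
  ΣL xs f = foldr (λ a r → f a +ᴷ r) 0# xs

  when : Bool → R → R
  when b r = if b then r else 0#

  sgn : ℕ → R
  sgn zero    = 1#
  sgn (suc n) = -ᴷ sgn n

  _≈Λ_ : ∀ {k} → Λ k → Λ k → Set ℓ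
  x ≈Λ y = ∀ S → x S ≈ y S

  0Λ : ∀ {k} → Λ k
  0Λ _ = 0#

  _+Λ_ : ∀ {k} → Λ k → Λ k → Λ k
  (x +Λ y) S = x S +ᴷ y S

  -Λ_ : ∀ {k} → Λ k → Λ k
  (-Λ x) S = -ᴷ x S

  _-Λ_ : ∀ {k} → Λ k → Λ k → Λ k
  x -Λ y = x +Λ (-Λ y)

  _·Λ_ : ∀ {k} → R → Λ k → Λ k
  (r ·Λ x) S = r *ᴷ x S

  mono : ∀ {k} → Subset k → Λ k
  mono S U = when (eqᵇ U S) 1#

  1Λ : ∀ {k} → Λ k
  1Λ = mono ∅

  gen : ∀ {k} → Fin k → Λ k
  gen i = mono ⁅ i ⁆

  _*Λ_ : ∀ {k} → Λ k → Λ k → Λ k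
  _*Λ_ {k} x y U = ΣL (allSubsets k) λ S → ΣL (allSubsets k) λ T →
    when (disjointᵇ S T ∧ eqᵇ (S ∪ T) U) (sgn (inv S T) *ᴷ (x S *ᴷ y T))

  ∂mono : ∀ {k} → Subset k → Λ k
  ∂mono {k} S U = ΣL (allFin k) λ i → when (lookup S i) (sgn (below i S) *ᴷ mono (S ∖ i) U)

  Homog : ∀ {k} → ℕ → Λ k → Set ℓ
  Homog d x = ∀ S → ¬ (∣ S ∣ ≡ d) → x S ≈ 0#

  data InIdeal {k} (Circ : Subset k → Set) : Λ k → Set (c ⊔ ℓ) where
    gen-mem : ∀ {C} → Circ C → (a b : Λ k) → InIdeal Circ ((a *Λ ∂mono C) *Λ b)
    zero-mem : InIdeal Circ 0Λ
    add-mem : ∀ {x y} → InIdeal Circ x → InIdeal Circ y → InIdeal Circ (x +Λ y)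
    resp-mem : ∀ {x y} → x ≈Λ y → InIdeal Circ x → InIdeal Circ y

  extend : ∀ {k k'} → (Fin k → Λ k') → Λ k → Λ k'
  extend {k} f x U = ΣL (allSubsets k) λ S →
    x S *ᴷ foldr _*Λ_ 1Λ (map f (elems S)) U

  φimg : ∀ {n m} → 3 ≤ n → Fin m → Fin (n + m) → Λ (n + m)
  φimg {n} {m} h ε0 x = [ onN , (λ ε → gen (cls0 {n} ε)) ] (splitAt n x)
    where
    ep : Λ (n + m)
    ep = gen (pSlot m h)
    onN : Fin n → Λ (n + m)
    onN i with i ≟ lastN h
    ... | yes _ = ep
    ... | no  _ = (gen (clsN ε0 i) -Λ gen (clsN ε0 (lastN h))) +Λ ep

  φ̂ : ∀ {n m} → 3 ≤ n → Fin m → Λ (n + m) → Λ (n + m)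
  φ̂ h ε0 = extend (φimg h ε0)

{-# OPTIONS --safe #-}
module Submission where

-- Every generator is sent by φ̂ to a degree-one element u with ∂ u = 1. Degree-one
-- elements anticommute and square to zero, so the map they determine is a graded
-- algebra homomorphism, and as ∂ is a graded derivation it commutes with ∂; hence
-- φ̂ (∂ e_C) = ∂ (φ̂ e_C) for every circuit C of M. For a circuit of M₀ this is ∂ ē_C.
-- For C = [n], put w = ∏_{i<n} (ē_i − ē_n): expanding the products (any term with
-- e_p, resp. ē_n, twice vanishes) gives φ̂ e_C = w e_p and ē_1 ⋯ ē_n = w ē_n, and since
-- ∂ w = 0 both have boundary ι w = ± w. So φ̂ (∂ e_[n]) = ± ∂ e_T, where T, the image of [n],
-- is a circuit of P^n_{ε₀}. Surjectivity: the image contains e_p = φ̂ e_n and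
-- ē_ε = φ̂ e_ε (in particular ē_1), hence ē_n = ē_1 + e_p − φ̂ e_1 and
-- ē_i = φ̂ e_i + ē_n − e_p.

open import Defs
open import Level using (Level; _⊔_)
open import Function using (_∘_)
open import Data.Nat as ℕ using (ℕ; zero; suc; z≤n; s≤s; _≤_)
open import Data.Nat.Properties using (+-suc) renaming (_≟_ to _≟ℕ_)
open import Data.Bool as B using (Bool; true; false; _∧_; _∨_; not)
open import Data.Bool.Properties using (∧-assoc; ∧-zeroʳ)
open import Data.Vec using ([]; _∷_; lookup; _++_; here; there)
open import Data.Vec.Properties using (≡-dec; ∷-injective)
open import Data.List using (List; []; _∷_; foldr; map; length; allFin; tabulate) renaming (_++_ to _++ₗ_)
open import Data.List.Properties using (length-map; map-tabulate; map-∘; map-cong-local)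
open import Data.List.Relation.Unary.All using (All; []; _∷_)
open import Data.List.Relation.Unary.All.Properties using (map⁺)
open import Data.Fin using (Fin; zero; suc; _↑ˡ_; _↑ʳ_; splitAt; fromℕ; inject₁) renaming (_≟_ to _≟F_)
open import Data.Fin.Properties using (splitAt-↑ˡ; splitAt-↑ʳ; fromℕ≢inject₁)
open import Data.Fin.Subset using (Subset; ∣_∣; ⁅_⁆; _∪_; _─_; _∈_) renaming (⊥ to ∅; ⊤ to full; _-_ to _∖_)
open import Data.Fin.Subset.Properties using (p─⊥≡p; ∣⊥∣≡0; ∈⊤; ∉⊥; x∈⁅x⁆; x∈⁅y⁆⇒x≡y; ∪-identityˡ; ∪-identityʳ)
open import Data.Product using (Σ; ∃; _×_; _,_; proj₂)
open import Data.Sum using (_⊎_; inj₁; inj₂)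
open import Data.Empty using (⊥-elim)
open import Relation.Nullary using (yes; no; ¬_; does)
open import Relation.Binary.Bundles using (Setoid)
open import Relation.Binary.PropositionalEquality as P using (_≡_; _≢_)
open import Algebra.Bundles using (CommutativeRing)
import Relation.Binary.Reasoning.Setoid as SetoidReasoning
import Algebra.Solver.CommutativeMonoid as CommutativeMonoidSolver

eqᵇ≡does : ∀ {k} (S T : Subset k) → eqᵇ S T ≡ does (≡-dec B._≟_ S T)
eqᵇ≡does S T with ≡-dec B._≟_ S T
... | yes _ = P.refl
... | no _  = P.refl

eqᵇ-∷-∷ : ∀ {k} b (S T : Subset k) → eqᵇ (b ∷ S) (b ∷ T) ≡ eqᵇ S T
eqᵇ-∷-∷ true  S T = P.trans (eqᵇ≡does (true ∷ S) (true ∷ T)) (P.sym (eqᵇ≡does S T))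
eqᵇ-∷-∷ false S T = P.trans (eqᵇ≡does (false ∷ S) (false ∷ T)) (P.sym (eqᵇ≡does S T))

eqᵇ-true-false : ∀ {k} (S T : Subset k) → eqᵇ (true ∷ S) (false ∷ T) ≡ false
eqᵇ-true-false S T = eqᵇ≡does (true ∷ S) (false ∷ T)

eqᵇ-false-true : ∀ {k} (S T : Subset k) → eqᵇ (false ∷ S) (true ∷ T) ≡ false
eqᵇ-false-true S T = eqᵇ≡does (false ∷ S) (true ∷ T)

eqᵇ⇒≡ : ∀ {k} {S T : Subset k} → eqᵇ S T ≡ true → S ≡ T
eqᵇ⇒≡ {S = S} {T} e with ≡-dec B._≟_ S T
... | yes S≡T = S≡T
eqᵇ⇒≡ () | no _

≢⇒eqᵇ-false : ∀ {k} {S T : Subset k} → S ≢ T → eqᵇ S T ≡ false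
≢⇒eqᵇ-false {S = S} {T} S≢T with ≡-dec B._≟_ S T
... | yes S≡T = ⊥-elim (S≢T S≡T)
... | no _    = P.refl

eqᵇ-refl : ∀ {k} (S : Subset k) → eqᵇ S S ≡ true
eqᵇ-refl S with ≡-dec B._≟_ S S
... | yes _   = P.refl
... | no S≢S  = ⊥-elim (S≢S P.refl)

eqᵇ-sym : ∀ {k} (S T : Subset k) → eqᵇ S T ≡ eqᵇ T S
eqᵇ-sym S T with ≡-dec B._≟_ S T
... | yes P.refl = P.sym (eqᵇ-refl S)
... | no S≢T   = P.sym (≢⇒eqᵇ-false (S≢T ∘ P.sym))

∧-true⁻ : ∀ {a b} → a ∧ b ≡ true → a ≡ true × b ≡ true
∧-true⁻ {true} {true} _ = P.refl , P.refl

elems-∅ : ∀ {k} → elems (∅ {k}) ≡ []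
elems-∅ {zero}  = P.refl
elems-∅ {suc k} = P.cong (map suc) (elems-∅ {k})

elems-⁅⁆ : ∀ {k} (i : Fin k) → elems ⁅ i ⁆ ≡ i ∷ []
elems-⁅⁆ {suc k} zero = P.cong (λ l → zero ∷ map suc l) (elems-∅ {k})
elems-⁅⁆ (suc i)      = P.cong (map suc) (elems-⁅⁆ i)

length-elems : ∀ {k} (S : Subset k) → length (elems S) ≡ ∣ S ∣
length-elems []          = P.refl
length-elems (true ∷ S)  = P.cong suc (P.trans (length-map suc (elems S)) (length-elems S))
length-elems (false ∷ S) = P.trans (length-map suc (elems S)) (length-elems S)

elems-All : ∀ {k p} {P : Fin k → Set p} (S : Subset k) → (∀ i → i ∈ S → P i) → All P (elems S)
elems-All []          g = []
elems-All (true ∷ S)  g = g zero here ∷ map⁺ (elems-All S λ i i∈S → g (suc i) (there i∈S))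
elems-All (false ∷ S) g = map⁺ (elems-All S λ i i∈S → g (suc i) (there i∈S))

elems-⊤++∅ : ∀ n {m} → elems (full {n} ++ ∅ {m}) ≡ tabulate (_↑ˡ m)
elems-⊤++∅ zero    {m} = elems-∅ {m}
elems-⊤++∅ (suc n) {m} = P.cong (zero ∷_) (P.trans (P.cong (map suc) (elems-⊤++∅ n)) (map-tabulate (_↑ˡ m) suc))

∣∪∣-disjoint : ∀ {k} (S T : Subset k) → disjointᵇ S T ≡ true → ∣ S ∪ T ∣ ≡ ∣ S ∣ ℕ.+ ∣ T ∣
∣∪∣-disjoint []          []          _  = P.refl
∣∪∣-disjoint (true ∷ S)  (false ∷ T) d = P.cong suc (∣∪∣-disjoint S T d)
∣∪∣-disjoint (false ∷ S) (true ∷ T)  d = P.trans (P.cong suc (∣∪∣-disjoint S T d)) (P.sym (+-suc ∣ S ∣ ∣ T ∣))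
∣∪∣-disjoint (false ∷ S) (false ∷ T) d = ∣∪∣-disjoint S T d

disjointᵇ-++ : ∀ {a b} (A C : Subset a) (B D : Subset b) → disjointᵇ (A ++ B) (C ++ D) ≡ disjointᵇ A C ∧ disjointᵇ B D
disjointᵇ-++ []      []      B D = P.refl
disjointᵇ-++ (x ∷ A) (y ∷ C) B D = P.trans (P.cong (not (x ∧ y) ∧_) (disjointᵇ-++ A C B D)) (P.sym (∧-assoc (not (x ∧ y)) _ _))

disjointᵇ-∅ˡ : ∀ {k} (S : Subset k) → disjointᵇ ∅ S ≡ true
disjointᵇ-∅ˡ []      = P.refl
disjointᵇ-∅ˡ (_ ∷ S) = disjointᵇ-∅ˡ S

disjointᵇ-∅ʳ : ∀ {k} (S : Subset k) → disjointᵇ S ∅ ≡ true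
disjointᵇ-∅ʳ []          = P.refl
disjointᵇ-∅ʳ (true ∷ S)  = disjointᵇ-∅ʳ S
disjointᵇ-∅ʳ (false ∷ S) = disjointᵇ-∅ʳ S

∪-++ : ∀ {a b} (A C : Subset a) (B D : Subset b) → (A ++ B) ∪ (C ++ D) ≡ (A ∪ C) ++ (B ∪ D)
∪-++ []      []      B D = P.refl
∪-++ (x ∷ A) (y ∷ C) B D = P.cong ((x ∨ y) ∷_) (∪-++ A C B D)


⁅↑ʳ⁆ : ∀ n {m} (ε : Fin m) → ⁅ n ↑ʳ ε ⁆ ≡ ∅ {n} ++ ⁅ ε ⁆
⁅↑ʳ⁆ zero    ε = P.refl
⁅↑ʳ⁆ (suc n) ε = P.cong (false ∷_) (⁅↑ʳ⁆ n ε)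

∈-++⁺ˡ : ∀ {n m} {i : Fin n} {A : Subset n} (D : Subset m) → i ∈ A → i ↑ˡ m ∈ A ++ D
∈-++⁺ˡ D here      = here
∈-++⁺ˡ D (there p) = there (∈-++⁺ˡ D p)

∈-++⁺ʳ : ∀ {n m} {ε : Fin m} (A : Subset n) {D : Subset m} → ε ∈ D → n ↑ʳ ε ∈ A ++ D
∈-++⁺ʳ []      p = p
∈-++⁺ʳ (_ ∷ A) p = there (∈-++⁺ʳ A p)

∈-++⁻ : ∀ {n m} (A : Subset n) {D : Subset m} {y : Fin (n ℕ.+ m)} → y ∈ A ++ D →
        (∃ λ i → i ∈ A × i ↑ˡ m ≡ y) ⊎ (∃ λ ε → ε ∈ D × n ↑ʳ ε ≡ y)
∈-++⁻ []      p         = inj₂ (_ , p , P.refl)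
∈-++⁻ (_ ∷ A) here      = inj₁ (zero , here , P.refl)
∈-++⁻ (_ ∷ A) (there p) with ∈-++⁻ A p
... | inj₁ (i , i∈A , P.refl) = inj₁ (suc i , there i∈A , P.refl)
... | inj₂ (ε , ε∈D , P.refl) = inj₂ (ε , ε∈D , P.refl)

inject₁-or-fromℕ : ∀ {k} (i : Fin (suc k)) → (∃ λ j → inject₁ j ≡ i) ⊎ i ≡ fromℕ k
inject₁-or-fromℕ {zero}  zero    = inj₂ P.refl
inject₁-or-fromℕ {suc k} zero    = inj₁ (zero , P.refl)
inject₁-or-fromℕ {suc k} (suc i) with inject₁-or-fromℕ i
... | inj₁ (j , P.refl) = inj₁ (suc j , P.refl)
... | inj₂ P.refl       = inj₂ P.refl

↑ˡ-or-↑ʳ : ∀ n {m} (t : Fin (n ℕ.+ m)) → (∃ λ i → i ↑ˡ m ≡ t) ⊎ (∃ λ ε → n ↑ʳ ε ≡ t)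
↑ˡ-or-↑ʳ zero    t       = inj₂ (t , P.refl)
↑ˡ-or-↑ʳ (suc n) zero    = inj₁ (zero , P.refl)
↑ˡ-or-↑ʳ (suc n) (suc t) with ↑ˡ-or-↑ʳ n t
... | inj₁ (i , P.refl) = inj₁ (suc i , P.refl)
... | inj₂ (ε , P.refl) = inj₂ (ε , P.refl)

module ExteriorAlgebra {c ℓ} (K : CommutativeRing c ℓ) where

  open CommutativeRing K hiding (zero) renaming (Carrier to R)
  open import Algebra.Properties.Ring ring using (-0#≈0#; -‿involutive; -‿+-comm; -‿distribˡ-*; -‿distribʳ-*)
  open Ext K public
    renaming ( _*Λ_ to infixl 7 _*Λ_; _+Λ_ to infixl 6 _+Λ_; _-Λ_ to infixl 6 _-Λ_
             ; _·Λ_ to infixr 8 _·Λ_; _≈Λ_ to infix 4 _≈Λ_ )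
  module +-Solver = CommutativeMonoidSolver +-commutativeMonoid
  module *-Solver = CommutativeMonoidSolver *-commutativeMonoid
  module ≈-Reasoning = SetoidReasoning setoid
  open import Algebra.Properties.CommutativeSemigroup +-commutativeSemigroup using () renaming (interchange to +-interchange)

  ΣL-cong : ∀ {a} {A : Set a} (xs : List A) {f g : A → R} → (∀ x → f x ≈ g x) → ΣL xs f ≈ ΣL xs g
  ΣL-cong []       f≈g = refl
  ΣL-cong (x ∷ xs) f≈g = +-cong (f≈g x) (ΣL-cong xs f≈g)

  ΣL-zero : ∀ {a} {A : Set a} (xs : List A) {f : A → R} → (∀ x → f x ≈ 0#) → ΣL xs f ≈ 0#
  ΣL-zero []       f≈0 = refl
  ΣL-zero (x ∷ xs) f≈0 = trans (+-cong (f≈0 x) (ΣL-zero xs f≈0)) (+-identityˡ 0#)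

  ΣL-++ : ∀ {a} {A : Set a} (xs ys : List A) (f : A → R) → ΣL (xs ++ₗ ys) f ≈ ΣL xs f + ΣL ys f
  ΣL-++ []       ys f = sym (+-identityˡ _)
  ΣL-++ (x ∷ xs) ys f = trans (+-cong refl (ΣL-++ xs ys f)) (sym (+-assoc _ _ _))

  ΣL-map : ∀ {a b} {A : Set a} {B : Set b} (xs : List A) (g : A → B) (f : B → R) → ΣL (map g xs) f ≡ ΣL xs (f ∘ g)
  ΣL-map []       g f = P.refl
  ΣL-map (x ∷ xs) g f = P.cong (f (g x) +_) (ΣL-map xs g f)

  ΣL-+ : ∀ {a} {A : Set a} (xs : List A) (f g : A → R) → ΣL xs (λ x → f x + g x) ≈ ΣL xs f + ΣL xs g
  ΣL-+ []       f g = sym (+-identityˡ 0#)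
  ΣL-+ (x ∷ xs) f g = trans (+-cong refl (ΣL-+ xs f g))
    (+-interchange (f x) (g x) (ΣL xs f) (ΣL xs g))

  ΣL-*ˡ : ∀ {a} {A : Set a} (xs : List A) (r : R) (f : A → R) → r * ΣL xs f ≈ ΣL xs (λ x → r * f x)
  ΣL-*ˡ []       r f = zeroʳ r
  ΣL-*ˡ (x ∷ xs) r f = trans (distribˡ r (f x) (ΣL xs f)) (+-cong refl (ΣL-*ˡ xs r f))

  ΣL-tabulate : ∀ {a} {A : Set a} {n} (f : Fin n → A) (g : A → R) → ΣL (tabulate f) g ≡ ΣL (allFin n) (g ∘ f)
  ΣL-tabulate {n = zero}  f g = P.refl
  ΣL-tabulate {n = suc n} f g =
    P.cong (g (f zero) +_) (P.trans (ΣL-tabulate (f ∘ suc) g) (P.sym (ΣL-tabulate suc (g ∘ f))))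

  ΣL-allFin-suc : ∀ n (g : Fin (suc n) → R) → ΣL (allFin (suc n)) g ≡ g zero + ΣL (allFin n) (g ∘ suc)
  ΣL-allFin-suc n g = P.cong (g zero +_) (ΣL-tabulate suc g)

  ΣL-allSubsets-suc : ∀ k (f : Subset (suc k) → R) →
    ΣL (allSubsets (suc k)) f ≈ ΣL (allSubsets k) (f ∘ (true ∷_)) + ΣL (allSubsets k) (f ∘ (false ∷_))
  ΣL-allSubsets-suc k f = trans (ΣL-++ (map (true ∷_) (allSubsets k)) (map (false ∷_) (allSubsets k)) f)
    (+-cong (reflexive (ΣL-map (allSubsets k) (true ∷_) f)) (reflexive (ΣL-map (allSubsets k) (false ∷_) f)))

  ΣL-allSubsets-point : ∀ {k} (A : Subset k) (f : Subset k → R) → (∀ S → S ≢ A → f S ≈ 0#) → ΣL (allSubsets k) f ≈ f A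
  ΣL-allSubsets-point {zero}  [] f _ = +-identityʳ (f [])
  ΣL-allSubsets-point {suc k} (true ∷ A) f vanish = begin
    ΣL (allSubsets (suc k)) f ≈⟨ ΣL-allSubsets-suc k f ⟩
    _                         ≈⟨ +-cong (ΣL-allSubsets-point A (f ∘ (true ∷_)) (λ S S≢A → vanish _ (S≢A ∘ proj₂ ∘ ∷-injective)))
                                        (ΣL-zero (allSubsets k) (λ S → vanish (false ∷ S) (λ ()))) ⟩
    f (true ∷ A) + 0#         ≈⟨ +-identityʳ _ ⟩
    f (true ∷ A)              ∎
    where open ≈-Reasoning
  ΣL-allSubsets-point {suc k} (false ∷ A) f vanish = begin
    ΣL (allSubsets (suc k)) f ≈⟨ ΣL-allSubsets-suc k f ⟩
    _                         ≈⟨ +-cong (ΣL-zero (allSubsets k) (λ S → vanish (true ∷ S) (λ ())))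
                                        (ΣL-allSubsets-point A (f ∘ (false ∷_)) (λ S S≢A → vanish _ (S≢A ∘ proj₂ ∘ ∷-injective))) ⟩
    0# + f (false ∷ A)        ≈⟨ +-identityˡ _ ⟩
    f (false ∷ A)             ∎
    where open ≈-Reasoning

  ΣΣ : ∀ k → (Subset k → Subset k → R) → R
  ΣΣ k f = ΣL (allSubsets k) λ S → ΣL (allSubsets k) λ T → f S T

  ΣΣ-cong : ∀ k {f g : Subset k → Subset k → R} → (∀ S T → f S T ≈ g S T) → ΣΣ k f ≈ ΣΣ k g
  ΣΣ-cong k f≈g = ΣL-cong (allSubsets k) λ S → ΣL-cong (allSubsets k) (f≈g S)

  ΣΣ-zero : ∀ k {f : Subset k → Subset k → R} → (∀ S T → f S T ≈ 0#) → ΣΣ k f ≈ 0#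
  ΣΣ-zero k f≈0 = ΣL-zero (allSubsets k) λ S → ΣL-zero (allSubsets k) (f≈0 S)

  ΣΣ-+ : ∀ k (f g : Subset k → Subset k → R) → ΣΣ k (λ S T → f S T + g S T) ≈ ΣΣ k f + ΣΣ k g
  ΣΣ-+ k f g = trans (ΣL-cong (allSubsets k) (λ S → ΣL-+ (allSubsets k) (f S) (g S))) (ΣL-+ (allSubsets k) _ _)

  ΣΣ-*ˡ : ∀ k r (f : Subset k → Subset k → R) → r * ΣΣ k f ≈ ΣΣ k (λ S T → r * f S T)
  ΣΣ-*ˡ k r f = trans (ΣL-*ˡ (allSubsets k) r _) (ΣL-cong (allSubsets k) (λ S → ΣL-*ˡ (allSubsets k) r (f S)))

  ΣΣ-suc : ∀ k (f : Subset (suc k) → Subset (suc k) → R) →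
    ΣΣ (suc k) f ≈ (ΣΣ k (λ S T → f (true ∷ S) (true ∷ T)) + ΣΣ k (λ S T → f (true ∷ S) (false ∷ T)))
                 + (ΣΣ k (λ S T → f (false ∷ S) (true ∷ T)) + ΣΣ k (λ S T → f (false ∷ S) (false ∷ T)))
  ΣΣ-suc k f = trans (ΣL-allSubsets-suc k (λ S → ΣL (allSubsets (suc k)) (f S)))
    (+-cong (trans (ΣL-cong (allSubsets k) (λ S → ΣL-allSubsets-suc k (f (true ∷ S)))) (ΣL-+ (allSubsets k) _ _))
            (trans (ΣL-cong (allSubsets k) (λ S → ΣL-allSubsets-suc k (f (false ∷ S)))) (ΣL-+ (allSubsets k) _ _)))

  when-cong : ∀ b {r s} → r ≈ s → when b r ≈ when b s
  when-cong true  r≈s = r≈s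
  when-cong false _   = refl

  when-zero : ∀ b {r} → r ≈ 0# → when b r ≈ 0#
  when-zero true  r≈0 = r≈0
  when-zero false _   = refl

  when-+ : ∀ b r s → when b (r + s) ≈ when b r + when b s
  when-+ true  r s = refl
  when-+ false r s = sym (+-identityˡ 0#)

  when-*ˡ : ∀ b r s → when b (r * s) ≈ r * when b s
  when-*ˡ true  r s = refl
  when-*ˡ false r s = sym (zeroʳ r)

  when-neg : ∀ b r → when b (- r) ≈ - when b r
  when-neg true  r = refl
  when-neg false r = sym -0#≈0#

  when-∧-false : ∀ b {b′} r → b′ ≡ false → when (b ∧ b′) r ≈ 0#
  when-∧-false b r P.refl rewrite ∧-zeroʳ b = refl

  neg*neg : ∀ a b → - a * - b ≈ a * b
  neg*neg a b = trans (sym (-‿distribˡ-* a (- b))) (trans (-‿cong (sym (-‿distribʳ-* a b))) (-‿involutive (a * b)))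

  sgn-+ : ∀ a b → sgn (a ℕ.+ b) ≈ sgn a * sgn b
  sgn-+ zero    b = sym (*-identityˡ (sgn b))
  sgn-+ (suc a) b = trans (-‿cong (sgn-+ a b)) (-‿distribˡ-* (sgn a) (sgn b))

  sgn-square : ∀ a → sgn a * sgn a ≈ 1#
  sgn-square zero    = *-identityˡ 1#
  sgn-square (suc a) = trans (neg*neg (sgn a) (sgn a)) (sgn-square a)

  Λ-setoid : ℕ → Setoid c ℓ
  Λ-setoid k = record
    { Carrier       = Λ k
    ; _≈_           = _≈Λ_
    ; isEquivalence = record { refl = λ _ → refl ; sym = λ x≈y S → sym (x≈y S) ; trans = λ x≈y y≈z S → trans (x≈y S) (y≈z S) }
    }

  module ≈Λ-Reasoning {k} = SetoidReasoning (Λ-setoid k)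

  module _ {k : ℕ} where
    open Setoid (Λ-setoid k) public using () renaming (refl to ≈Λ-refl; sym to ≈Λ-sym; trans to ≈Λ-trans; reflexive to ≈Λ-reflexive)

  -- x = e₀ *Λ hd x +Λ tl x, where hd x and tl x only involve e₁, e₂, …
  hd tl : ∀ {k} → Λ (suc k) → Λ k
  hd x S = x (true ∷ S)
  tl x S = x (false ∷ S)

  ≈Λ-from-hd-tl : ∀ {k} {x y : Λ (suc k)} → hd x ≈Λ hd y → tl x ≈Λ tl y → x ≈Λ y
  ≈Λ-from-hd-tl hd≈ tl≈ (true ∷ S)  = hd≈ S
  ≈Λ-from-hd-tl hd≈ tl≈ (false ∷ S) = tl≈ S

  hd-cong : ∀ {k} {x y : Λ (suc k)} → x ≈Λ y → hd x ≈Λ hd y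
  hd-cong x≈y S = x≈y (true ∷ S)

  tl-cong : ∀ {k} {x y : Λ (suc k)} → x ≈Λ y → tl x ≈Λ tl y
  tl-cong x≈y S = x≈y (false ∷ S)

  ι : ∀ {k} → Λ k → Λ k
  ι x S = sgn ∣ S ∣ * x S

  hd-ι : ∀ {k} (x : Λ (suc k)) → hd (ι x) ≈Λ -Λ ι (hd x)
  hd-ι x S = sym (-‿distribˡ-* (sgn ∣ S ∣) (x (true ∷ S)))

  tl-ι : ∀ {k} (x : Λ (suc k)) → tl (ι x) ≈Λ ι (tl x)
  tl-ι x S = refl

  hd-*Λ : ∀ {k} (x y : Λ (suc k)) → hd (x *Λ y) ≈Λ hd x *Λ tl y +Λ ι (tl x) *Λ hd y
  hd-*Λ {k} x y U = trans (ΣΣ-suc k _)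
    (trans (+-cong (+-cong (ΣΣ-zero k λ _ _ → refl) (ΣΣ-cong k true-false))
                   (+-cong (ΣΣ-cong k false-true) (ΣΣ-zero k false-false)))
           (+-cong (+-identityˡ _) (+-identityʳ _)))
    where
    true-false : ∀ S T → _
    true-false S T = reflexive (P.cong (λ b → when (disjointᵇ S T ∧ b) (sgn (inv S T) * (x (true ∷ S) * y (false ∷ T))))
                                         (eqᵇ-∷-∷ true (S ∪ T) U))
    false-true : ∀ S T → _
    false-true S T = trans
      (reflexive (P.cong (λ b → when (disjointᵇ S T ∧ b) (sgn (∣ S ∣ ℕ.+ inv S T) * (x (false ∷ S) * y (true ∷ T))))
                           (eqᵇ-∷-∷ true (S ∪ T) U)))
      (when-cong (disjointᵇ S T ∧ eqᵇ (S ∪ T) U)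
        (trans (*-cong (sgn-+ ∣ S ∣ (inv S T)) refl)
               (*-Solver.solve 4 (λ a b p q → ((a ⊕ b) ⊕ (p ⊕ q)) ⊜ (b ⊕ ((a ⊕ p) ⊕ q))) refl
                                 (sgn ∣ S ∣) (sgn (inv S T)) (x (false ∷ S)) (y (true ∷ T)))))
      where open *-Solver using (_⊕_; _⊜_)
    false-false : ∀ S T → _
    false-false S T = when-∧-false (disjointᵇ S T) (sgn (inv S T) * (x (false ∷ S) * y (false ∷ T))) (eqᵇ-false-true (S ∪ T) U)

  tl-*Λ : ∀ {k} (x y : Λ (suc k)) → tl (x *Λ y) ≈Λ tl x *Λ tl y
  tl-*Λ {k} x y U = trans (ΣΣ-suc k _)
    (trans (+-cong (+-cong (ΣΣ-zero k λ _ _ → refl) (ΣΣ-zero k true-false)) (+-cong (ΣΣ-zero k false-true) (ΣΣ-cong k false-false)))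
           (trans (+-cong (+-identityˡ 0#) (+-identityˡ _)) (+-identityˡ _)))
    where
    true-false : ∀ S T → _
    true-false S T = when-∧-false (disjointᵇ S T) (sgn (inv S T) * (x (true ∷ S) * y (false ∷ T))) (eqᵇ-true-false (S ∪ T) U)
    false-true : ∀ S T → _
    false-true S T =
      when-∧-false (disjointᵇ S T) (sgn (∣ S ∣ ℕ.+ inv S T) * (x (false ∷ S) * y (true ∷ T))) (eqᵇ-true-false (S ∪ T) U)
    false-false : ∀ S T → _
    false-false S T = reflexive (P.cong (λ b → when (disjointᵇ S T ∧ b) (sgn (inv S T) * (x (false ∷ S) * y (false ∷ T))))
                                          (eqᵇ-∷-∷ false (S ∪ T) U))

  *Λ-at-[] : (x y : Λ 0) → (x *Λ y) [] ≈ x [] * y []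
  *Λ-at-[] x y = trans (+-identityʳ _) (trans (+-identityʳ _) (*-identityˡ _))

  +Λ-cong : ∀ {k} {x x′ y y′ : Λ k} → x ≈Λ x′ → y ≈Λ y′ → x +Λ y ≈Λ x′ +Λ y′
  +Λ-cong x≈ y≈ S = +-cong (x≈ S) (y≈ S)

  -Λ-cong : ∀ {k} {x x′ : Λ k} → x ≈Λ x′ → -Λ x ≈Λ -Λ x′
  -Λ-cong x≈ S = -‿cong (x≈ S)

  ·Λ-cong : ∀ {k} r {x x′ : Λ k} → x ≈Λ x′ → r ·Λ x ≈Λ r ·Λ x′
  ·Λ-cong r x≈ S = *-cong refl (x≈ S)

  ι-cong : ∀ {k} {x x′ : Λ k} → x ≈Λ x′ → ι x ≈Λ ι x′
  ι-cong x≈ S = *-cong refl (x≈ S)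

  *Λ-cong : ∀ {k} {x x′ y y′ : Λ k} → x ≈Λ x′ → y ≈Λ y′ → x *Λ y ≈Λ x′ *Λ y′
  *Λ-cong {k} x≈ y≈ U = ΣΣ-cong k λ S T → when-cong (disjointᵇ S T ∧ eqᵇ (S ∪ T) U) (*-cong refl (*-cong (x≈ S) (y≈ T)))

  *Λ-congˡ : ∀ {k} {x x′ y : Λ k} → x ≈Λ x′ → x *Λ y ≈Λ x′ *Λ y
  *Λ-congˡ x≈ = *Λ-cong x≈ ≈Λ-refl

  *Λ-congʳ : ∀ {k} {x y y′ : Λ k} → y ≈Λ y′ → x *Λ y ≈Λ x *Λ y′
  *Λ-congʳ = *Λ-cong ≈Λ-refl

  -Λ-+Λ : ∀ {k} (x y : Λ k) → -Λ (x +Λ y) ≈Λ -Λ x +Λ -Λ y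
  -Λ-+Λ x y S = sym (-‿+-comm (x S) (y S))

  -Λ≈-1·Λ : ∀ {k} (x : Λ k) → -Λ x ≈Λ (- 1#) ·Λ x
  -Λ≈-1·Λ x S = trans (-‿cong (sym (*-identityˡ _))) (-‿distribˡ-* _ _)

  *Λ-distribˡ : ∀ {k} (x y z : Λ k) → x *Λ (y +Λ z) ≈Λ x *Λ y +Λ x *Λ z
  *Λ-distribˡ {k} x y z U = trans (ΣΣ-cong k λ S T → trans (when-cong (disjointᵇ S T ∧ eqᵇ (S ∪ T) U)
      (trans (*-cong refl (distribˡ (x S) (y T) (z T))) (distribˡ _ _ _))) (when-+ _ _ _)) (ΣΣ-+ k _ _)

  *Λ-distribʳ : ∀ {k} (x y z : Λ k) → (y +Λ z) *Λ x ≈Λ y *Λ x +Λ z *Λ x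
  *Λ-distribʳ {k} x y z U = trans (ΣΣ-cong k λ S T → trans (when-cong (disjointᵇ S T ∧ eqᵇ (S ∪ T) U)
      (trans (*-cong refl (distribʳ (x T) (y S) (z S))) (distribˡ _ _ _))) (when-+ _ _ _)) (ΣΣ-+ k _ _)

  *Λ-·Λˡ : ∀ {k} r (x y : Λ k) → (r ·Λ x) *Λ y ≈Λ r ·Λ (x *Λ y)
  *Λ-·Λˡ {k} r x y U = trans (ΣΣ-cong k λ S T → trans (when-cong (disjointᵇ S T ∧ eqᵇ (S ∪ T) U)
      (*-Solver.solve 4 (λ r s a b → (s ⊕ ((r ⊕ a) ⊕ b)) ⊜ (r ⊕ (s ⊕ (a ⊕ b)))) refl r (sgn (inv S T)) (x S) (y T)))
      (when-*ˡ _ _ _)) (sym (ΣΣ-*ˡ k r _))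
    where open *-Solver using (_⊕_; _⊜_)

  *Λ-·Λʳ : ∀ {k} r (x y : Λ k) → x *Λ (r ·Λ y) ≈Λ r ·Λ (x *Λ y)
  *Λ-·Λʳ {k} r x y U = trans (ΣΣ-cong k λ S T → trans (when-cong (disjointᵇ S T ∧ eqᵇ (S ∪ T) U)
      (*-Solver.solve 4 (λ r s a b → (s ⊕ (a ⊕ (r ⊕ b))) ⊜ (r ⊕ (s ⊕ (a ⊕ b)))) refl r (sgn (inv S T)) (x S) (y T)))
      (when-*ˡ _ _ _)) (sym (ΣΣ-*ˡ k r _))
    where open *-Solver using (_⊕_; _⊜_)

  *Λ-zeroˡ : ∀ {k} (y : Λ k) → 0Λ *Λ y ≈Λ 0Λ
  *Λ-zeroˡ {k} y U = ΣΣ-zero k λ S T → when-zero (disjointᵇ S T ∧ eqᵇ (S ∪ T) U) (trans (*-cong refl (zeroˡ _)) (zeroʳ _))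

  *Λ-zeroʳ : ∀ {k} (x : Λ k) → x *Λ 0Λ ≈Λ 0Λ
  *Λ-zeroʳ {k} x U = ΣΣ-zero k λ S T → when-zero (disjointᵇ S T ∧ eqᵇ (S ∪ T) U) (trans (*-cong refl (zeroʳ _)) (zeroʳ _))

  *Λ-negˡ : ∀ {k} (x y : Λ k) → (-Λ x) *Λ y ≈Λ -Λ (x *Λ y)
  *Λ-negˡ x y = ≈Λ-trans (*Λ-congˡ (-Λ≈-1·Λ x)) (≈Λ-trans (*Λ-·Λˡ _ x y) (≈Λ-sym (-Λ≈-1·Λ _)))

  *Λ-negʳ : ∀ {k} (x y : Λ k) → x *Λ (-Λ y) ≈Λ -Λ (x *Λ y)
  *Λ-negʳ x y = ≈Λ-trans (*Λ-congʳ (-Λ≈-1·Λ y)) (≈Λ-trans (*Λ-·Λʳ _ x y) (≈Λ-sym (-Λ≈-1·Λ _)))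

  ι-+Λ : ∀ {k} (x y : Λ k) → ι (x +Λ y) ≈Λ ι x +Λ ι y
  ι-+Λ x y S = distribˡ _ _ _

  ι-neg : ∀ {k} (x : Λ k) → ι (-Λ x) ≈Λ -Λ ι x
  ι-neg x S = sym (-‿distribʳ-* _ _)

  ι-·Λ : ∀ {k} r (x : Λ k) → ι (r ·Λ x) ≈Λ r ·Λ ι x
  ι-·Λ r x S = *-Solver.solve 3 (λ s r a → (s ⊕ (r ⊕ a)) ⊜ (r ⊕ (s ⊕ a))) refl (sgn ∣ S ∣) r (x S)
    where open *-Solver using (_⊕_; _⊜_)

  ι-involutive : ∀ {k} (x : Λ k) → ι (ι x) ≈Λ x
  ι-involutive x S = trans (sym (*-assoc _ _ _)) (trans (*-cong (sgn-square ∣ S ∣) refl) (*-identityˡ _))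

  ι-0Λ : ∀ {k} → ι {k} 0Λ ≈Λ 0Λ
  ι-0Λ S = zeroʳ _

  ι-*Λ : ∀ {k} (x y : Λ k) → ι (x *Λ y) ≈Λ ι x *Λ ι y
  ι-*Λ {zero} x y [] = trans (*-identityˡ _) (trans (*Λ-at-[] x y)
    (trans (*-cong (sym (*-identityˡ _)) (sym (*-identityˡ _))) (sym (*Λ-at-[] (ι x) (ι y)))))
  ι-*Λ {suc k} x y = ≈Λ-from-hd-tl head tail
    where
    open ≈Λ-Reasoning
    head : hd (ι (x *Λ y)) ≈Λ hd (ι x *Λ ι y)
    head = begin
      hd (ι (x *Λ y))
        ≈⟨ hd-ι (x *Λ y) ⟩
      -Λ ι (hd (x *Λ y))
        ≈⟨ -Λ-cong (ι-cong (hd-*Λ x y)) ⟩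
      -Λ ι (hd x *Λ tl y +Λ ι (tl x) *Λ hd y)
        ≈⟨ -Λ-cong (ι-+Λ _ _) ⟩
      -Λ (ι (hd x *Λ tl y) +Λ ι (ι (tl x) *Λ hd y))
        ≈⟨ -Λ-cong (+Λ-cong (ι-*Λ (hd x) (tl y)) (ι-*Λ (ι (tl x)) (hd y))) ⟩
      -Λ (ι (hd x) *Λ ι (tl y) +Λ ι (ι (tl x)) *Λ ι (hd y))
        ≈⟨ -Λ-+Λ _ _ ⟩
      -Λ (ι (hd x) *Λ ι (tl y)) +Λ -Λ (ι (ι (tl x)) *Λ ι (hd y))
        ≈⟨ +Λ-cong (*Λ-negˡ _ _) (*Λ-negʳ _ _) ⟨
      (-Λ ι (hd x)) *Λ ι (tl y) +Λ ι (ι (tl x)) *Λ (-Λ ι (hd y))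
        ≈⟨ +Λ-cong (*Λ-cong (hd-ι x) (tl-ι y)) (*Λ-cong (ι-cong (tl-ι x)) (hd-ι y)) ⟨
      hd (ι x) *Λ tl (ι y) +Λ ι (tl (ι x)) *Λ hd (ι y)
        ≈⟨ hd-*Λ (ι x) (ι y) ⟨
      hd (ι x *Λ ι y) ∎
    tail : tl (ι (x *Λ y)) ≈Λ tl (ι x *Λ ι y)
    tail = begin
      tl (ι (x *Λ y))        ≈⟨ ι-cong (tl-*Λ x y) ⟩
      ι (tl x *Λ tl y)       ≈⟨ ι-*Λ (tl x) (tl y) ⟩
      ι (tl x) *Λ ι (tl y)   ≈⟨ tl-*Λ (ι x) (ι y) ⟨
      tl (ι x *Λ ι y)        ∎

  *Λ-assoc : ∀ {k} (x y z : Λ k) → (x *Λ y) *Λ z ≈Λ x *Λ (y *Λ z)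
  *Λ-assoc {zero} x y z [] = begin
    ((x *Λ y) *Λ z) []          ≈⟨ *Λ-at-[] (x *Λ y) z ⟩
    (x *Λ y) [] * z []          ≈⟨ *-cong (*Λ-at-[] x y) refl ⟩
    (x [] * y []) * z []        ≈⟨ *-assoc _ _ _ ⟩
    x [] * (y [] * z [])        ≈⟨ *-cong refl (*Λ-at-[] y z) ⟨
    x [] * (y *Λ z) []          ≈⟨ *Λ-at-[] x (y *Λ z) ⟨
    (x *Λ (y *Λ z)) []          ∎
    where open ≈-Reasoning
  *Λ-assoc {suc k} x y z = ≈Λ-from-hd-tl head tail
    where
    open ≈Λ-Reasoning
    x₁ = hd x; x₀ = tl x; y₁ = hd y; y₀ = tl y; z₁ = hd z; z₀ = tl z
    head : hd ((x *Λ y) *Λ z) ≈Λ hd (x *Λ (y *Λ z))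
    head = begin
      hd ((x *Λ y) *Λ z)
        ≈⟨ hd-*Λ (x *Λ y) z ⟩
      hd (x *Λ y) *Λ z₀ +Λ ι (tl (x *Λ y)) *Λ z₁
        ≈⟨ +Λ-cong (*Λ-congˡ (hd-*Λ x y)) (*Λ-congˡ (≈Λ-trans (ι-cong (tl-*Λ x y)) (ι-*Λ x₀ y₀))) ⟩
      (x₁ *Λ y₀ +Λ ι x₀ *Λ y₁) *Λ z₀ +Λ (ι x₀ *Λ ι y₀) *Λ z₁
        ≈⟨ +Λ-cong (*Λ-distribʳ z₀ _ _) ≈Λ-refl ⟩
      (x₁ *Λ y₀) *Λ z₀ +Λ (ι x₀ *Λ y₁) *Λ z₀ +Λ (ι x₀ *Λ ι y₀) *Λ z₁
        ≈⟨ (λ U → +-assoc _ _ _) ⟩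
      (x₁ *Λ y₀) *Λ z₀ +Λ ((ι x₀ *Λ y₁) *Λ z₀ +Λ (ι x₀ *Λ ι y₀) *Λ z₁)
        ≈⟨ +Λ-cong (*Λ-assoc x₁ y₀ z₀) (+Λ-cong (*Λ-assoc (ι x₀) y₁ z₀) (*Λ-assoc (ι x₀) (ι y₀) z₁)) ⟩
      x₁ *Λ (y₀ *Λ z₀) +Λ (ι x₀ *Λ (y₁ *Λ z₀) +Λ ι x₀ *Λ (ι y₀ *Λ z₁))
        ≈⟨ +Λ-cong ≈Λ-refl (*Λ-distribˡ (ι x₀) _ _) ⟨
      x₁ *Λ (y₀ *Λ z₀) +Λ ι x₀ *Λ (y₁ *Λ z₀ +Λ ι y₀ *Λ z₁)
        ≈⟨ +Λ-cong (*Λ-congʳ (tl-*Λ y z)) (*Λ-congʳ (hd-*Λ y z)) ⟨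
      x₁ *Λ tl (y *Λ z) +Λ ι x₀ *Λ hd (y *Λ z)
        ≈⟨ hd-*Λ x (y *Λ z) ⟨
      hd (x *Λ (y *Λ z)) ∎
    tail : tl ((x *Λ y) *Λ z) ≈Λ tl (x *Λ (y *Λ z))
    tail = begin
      tl ((x *Λ y) *Λ z)     ≈⟨ tl-*Λ (x *Λ y) z ⟩
      tl (x *Λ y) *Λ z₀      ≈⟨ *Λ-congˡ (tl-*Λ x y) ⟩
      (x₀ *Λ y₀) *Λ z₀       ≈⟨ *Λ-assoc x₀ y₀ z₀ ⟩
      x₀ *Λ (y₀ *Λ z₀)       ≈⟨ *Λ-congʳ (tl-*Λ y z) ⟨
      x₀ *Λ tl (y *Λ z)      ≈⟨ tl-*Λ x (y *Λ z) ⟨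
      tl (x *Λ (y *Λ z))     ∎

  hd-1Λ : ∀ {k} → hd (1Λ {suc k}) ≈Λ 0Λ
  hd-1Λ S rewrite eqᵇ-true-false S ∅ = refl

  tl-1Λ : ∀ {k} → tl (1Λ {suc k}) ≈Λ 1Λ
  tl-1Λ S rewrite eqᵇ-∷-∷ false S ∅ = refl

  ι-1Λ : ∀ {k} → ι (1Λ {k}) ≈Λ 1Λ
  ι-1Λ {zero} [] = *-identityˡ _
  ι-1Λ {suc k} = ≈Λ-from-hd-tl
    (≈Λ-trans (hd-ι 1Λ) (≈Λ-trans (-Λ-cong (≈Λ-trans (ι-cong (hd-1Λ {k})) ι-0Λ))
                                  (≈Λ-trans (λ _ → -0#≈0#) (≈Λ-sym hd-1Λ))))
    (≈Λ-trans (ι-cong (tl-1Λ {k})) (≈Λ-trans ι-1Λ (≈Λ-sym tl-1Λ)))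

  *Λ-identityˡ : ∀ {k} (x : Λ k) → 1Λ *Λ x ≈Λ x
  *Λ-identityˡ {zero} x [] = trans (*Λ-at-[] 1Λ x) (*-identityˡ _)
  *Λ-identityˡ {suc k} x = ≈Λ-from-hd-tl head tail
    where
    open ≈Λ-Reasoning
    head : hd (1Λ *Λ x) ≈Λ hd x
    head = begin
      hd (1Λ *Λ x)                             ≈⟨ hd-*Λ 1Λ x ⟩
      hd 1Λ *Λ tl x +Λ ι (tl 1Λ) *Λ hd x       ≈⟨ +Λ-cong (*Λ-congˡ (hd-1Λ {k}))
                                                          (*Λ-congˡ (≈Λ-trans (ι-cong (tl-1Λ {k})) ι-1Λ)) ⟩
      0Λ *Λ tl x +Λ 1Λ *Λ hd x                 ≈⟨ +Λ-cong (*Λ-zeroˡ (tl x)) (*Λ-identityˡ (hd x)) ⟩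
      0Λ +Λ hd x                               ≈⟨ (λ U → +-identityˡ _) ⟩
      hd x                                     ∎
    tail : tl (1Λ *Λ x) ≈Λ tl x
    tail = ≈Λ-trans (tl-*Λ 1Λ x) (≈Λ-trans (*Λ-congˡ (tl-1Λ {k})) (*Λ-identityˡ (tl x)))

  *Λ-identityʳ : ∀ {k} (x : Λ k) → x *Λ 1Λ ≈Λ x
  *Λ-identityʳ {zero} x [] = trans (*Λ-at-[] x 1Λ) (*-identityʳ _)
  *Λ-identityʳ {suc k} x = ≈Λ-from-hd-tl head tail
    where
    open ≈Λ-Reasoning
    head : hd (x *Λ 1Λ) ≈Λ hd x
    head = begin
      hd (x *Λ 1Λ)                             ≈⟨ hd-*Λ x 1Λ ⟩
      hd x *Λ tl 1Λ +Λ ι (tl x) *Λ hd 1Λ       ≈⟨ +Λ-cong (*Λ-congʳ (tl-1Λ {k})) (*Λ-congʳ (hd-1Λ {k})) ⟩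
      hd x *Λ 1Λ +Λ ι (tl x) *Λ 0Λ             ≈⟨ +Λ-cong (*Λ-identityʳ (hd x)) (*Λ-zeroʳ (ι (tl x))) ⟩
      hd x +Λ 0Λ                               ≈⟨ (λ U → +-identityʳ _) ⟩
      hd x                                     ∎
    tail : tl (x *Λ 1Λ) ≈Λ tl x
    tail = ≈Λ-trans (tl-*Λ x 1Λ) (≈Λ-trans (*Λ-congʳ (tl-1Λ {k})) (*Λ-identityʳ (tl x)))

  hd-mono-true : ∀ {k} (S : Subset k) → hd (mono (true ∷ S)) ≈Λ mono S
  hd-mono-true S U = reflexive (P.cong (λ b → when b 1#) (eqᵇ-∷-∷ true U S))

  tl-mono-true : ∀ {k} (S : Subset k) → tl (mono (true ∷ S)) ≈Λ 0Λ
  tl-mono-true S U = reflexive (P.cong (λ b → when b 1#) (eqᵇ-false-true U S))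

  hd-mono-false : ∀ {k} (S : Subset k) → hd (mono (false ∷ S)) ≈Λ 0Λ
  hd-mono-false S U = reflexive (P.cong (λ b → when b 1#) (eqᵇ-true-false U S))

  tl-mono-false : ∀ {k} (S : Subset k) → tl (mono (false ∷ S)) ≈Λ mono S
  tl-mono-false S U = reflexive (P.cong (λ b → when b 1#) (eqᵇ-∷-∷ false U S))

  mono-≢ : ∀ {k} {S U : Subset k} → U ≢ S → mono S U ≈ 0#
  mono-≢ U≢S rewrite ≢⇒eqᵇ-false U≢S = refl

  mono-refl : ∀ {k} (S : Subset k) → mono S S ≈ 1#
  mono-refl S rewrite eqᵇ-refl S = refl

  data Linear : ∀ {k} → Λ k → Set (c ⊔ ℓ) where
    linear-[] : ∀ {u : Λ 0} → u [] ≈ 0# → Linear u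
    linear-∷  : ∀ {k} {u : Λ (suc k)} (a : R) → hd u ≈Λ a ·Λ 1Λ → Linear (tl u) → Linear u

  Linear-cong : ∀ {k} {u v : Λ k} → u ≈Λ v → Linear u → Linear v
  Linear-cong u≈v (linear-[] u≈0)       = linear-[] (trans (sym (u≈v [])) u≈0)
  Linear-cong u≈v (linear-∷ a hd≈ tl-u) =
    linear-∷ a (≈Λ-trans (≈Λ-sym (hd-cong u≈v)) hd≈) (Linear-cong (tl-cong u≈v) tl-u)

  Linear-zero : ∀ {k} {u : Λ k} → u ≈Λ 0Λ → Linear u
  Linear-zero {zero}  u≈0 = linear-[] (u≈0 [])
  Linear-zero {suc k} u≈0 = linear-∷ 0# (λ S → trans (u≈0 (true ∷ S)) (sym (zeroˡ _))) (Linear-zero (tl-cong u≈0))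

  Linear-+Λ : ∀ {k} {u v : Λ k} → Linear u → Linear v → Linear (u +Λ v)
  Linear-+Λ (linear-[] u≈0) (linear-[] v≈0) = linear-[] (trans (+-cong u≈0 v≈0) (+-identityˡ 0#))
  Linear-+Λ (linear-∷ a hd-u tl-u) (linear-∷ b hd-v tl-v) =
    linear-∷ (a + b) (λ S → trans (+-cong (hd-u S) (hd-v S)) (sym (distribʳ _ _ _))) (Linear-+Λ tl-u tl-v)

  Linear-·Λ : ∀ {k} r {u : Λ k} → Linear u → Linear (r ·Λ u)
  Linear-·Λ r (linear-[] u≈0)       = linear-[] (trans (*-cong refl u≈0) (zeroʳ r))
  Linear-·Λ r (linear-∷ a hd-u tl-u) = linear-∷ (r * a) (λ S → trans (*-cong refl (hd-u S)) (sym (*-assoc _ _ _))) (Linear-·Λ r tl-u)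

  Linear-neg : ∀ {k} {u : Λ k} → Linear u → Linear (-Λ u)
  Linear-neg lu = Linear-cong (≈Λ-sym (-Λ≈-1·Λ _)) (Linear-·Λ _ lu)

  Linear-gen : ∀ {k} (i : Fin k) → Linear (gen i)
  Linear-gen {suc k} zero    = linear-∷ 1# (λ S → trans (hd-mono-true ∅ S) (sym (*-identityˡ _))) (Linear-zero (tl-mono-true ∅))
  Linear-gen {suc k} (suc i) =
    linear-∷ 0# (λ S → trans (hd-mono-false ⁅ i ⁆ S) (sym (zeroˡ _))) (Linear-cong (≈Λ-sym (tl-mono-false ⁅ i ⁆)) (Linear-gen i))

  ι-Linear : ∀ {k} {u : Λ k} → Linear u → ι u ≈Λ -Λ u
  ι-Linear (linear-[] u≈0) [] = trans (*-identityˡ _) (trans u≈0 (trans (sym -0#≈0#) (-‿cong (sym u≈0))))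
  ι-Linear {suc k} {u} (linear-∷ a hd-u tl-u) = ≈Λ-from-hd-tl head (ι-Linear tl-u)
    where
    open ≈Λ-Reasoning
    head : hd (ι u) ≈Λ hd (-Λ u)
    head = begin
      hd (ι u)         ≈⟨ hd-ι u ⟩
      -Λ ι (hd u)      ≈⟨ -Λ-cong (ι-cong hd-u) ⟩
      -Λ ι (a ·Λ 1Λ)   ≈⟨ -Λ-cong (≈Λ-trans (ι-·Λ a 1Λ) (·Λ-cong a ι-1Λ)) ⟩
      -Λ (a ·Λ 1Λ)     ≈⟨ -Λ-cong hd-u ⟨
      -Λ hd u          ∎

  Linear-*Λ-comm : ∀ {k} {u : Λ k} → Linear u → ∀ x → u *Λ x ≈Λ ι x *Λ u
  Linear-*Λ-comm {u = u} (linear-[] u≈0) x [] = begin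
    (u *Λ x) []      ≈⟨ *Λ-at-[] u x ⟩
    u [] * x []      ≈⟨ trans (*-cong u≈0 refl) (zeroˡ _) ⟩
    0#               ≈⟨ trans (*-cong refl u≈0) (zeroʳ _) ⟨
    ι x [] * u []    ≈⟨ *Λ-at-[] (ι x) u ⟨
    (ι x *Λ u) []    ∎
    where open ≈-Reasoning
  Linear-*Λ-comm {suc k} {u} (linear-∷ a hd-u tl-u) x = ≈Λ-from-hd-tl head tail
    where
    open ≈Λ-Reasoning
    head : hd (u *Λ x) ≈Λ hd (ι x *Λ u)
    head = begin
      hd (u *Λ x)
        ≈⟨ hd-*Λ u x ⟩
      hd u *Λ tl x +Λ ι (tl u) *Λ hd x
        ≈⟨ +Λ-cong (*Λ-congˡ hd-u) (*Λ-congˡ (ι-Linear tl-u)) ⟩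
      (a ·Λ 1Λ) *Λ tl x +Λ (-Λ tl u) *Λ hd x
        ≈⟨ +Λ-cong (≈Λ-trans (*Λ-·Λˡ a 1Λ (tl x)) (·Λ-cong a (*Λ-identityˡ (tl x)))) (*Λ-negˡ (tl u) (hd x)) ⟩
      a ·Λ tl x +Λ -Λ (tl u *Λ hd x)
        ≈⟨ +Λ-cong ≈Λ-refl (-Λ-cong (Linear-*Λ-comm tl-u (hd x))) ⟩
      a ·Λ tl x +Λ -Λ (ι (hd x) *Λ tl u)
        ≈⟨ (λ U → +-comm _ _) ⟩
      -Λ (ι (hd x) *Λ tl u) +Λ a ·Λ tl x
        ≈⟨ +Λ-cong (*Λ-negˡ (ι (hd x)) (tl u))
                   (≈Λ-trans (*Λ-·Λʳ a _ 1Λ) (·Λ-cong a (≈Λ-trans (*Λ-identityʳ _) (ι-involutive (tl x))))) ⟨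
      (-Λ ι (hd x)) *Λ tl u +Λ ι (ι (tl x)) *Λ (a ·Λ 1Λ)
        ≈⟨ +Λ-cong (*Λ-congˡ (hd-ι x)) (*Λ-cong (ι-cong (tl-ι x)) hd-u) ⟨
      hd (ι x) *Λ tl u +Λ ι (tl (ι x)) *Λ hd u
        ≈⟨ hd-*Λ (ι x) u ⟨
      hd (ι x *Λ u) ∎
    tail : tl (u *Λ x) ≈Λ tl (ι x *Λ u)
    tail = ≈Λ-trans (tl-*Λ u x) (≈Λ-trans (Linear-*Λ-comm tl-u (tl x)) (≈Λ-sym (tl-*Λ (ι x) u)))

  Linear-square : ∀ {k} {u : Λ k} → Linear u → u *Λ u ≈Λ 0Λ
  Linear-square {u = u} (linear-[] u≈0) [] = trans (*Λ-at-[] u u) (trans (*-cong u≈0 refl) (zeroˡ _))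
  Linear-square {suc k} {u} (linear-∷ a hd-u tl-u) = ≈Λ-from-hd-tl head (≈Λ-trans (tl-*Λ u u) (Linear-square tl-u))
    where
    open ≈Λ-Reasoning
    head : hd (u *Λ u) ≈Λ 0Λ
    head = begin
      hd (u *Λ u)
        ≈⟨ hd-*Λ u u ⟩
      hd u *Λ tl u +Λ ι (tl u) *Λ hd u
        ≈⟨ +Λ-cong (*Λ-congˡ hd-u) (*Λ-cong (ι-Linear tl-u) hd-u) ⟩
      (a ·Λ 1Λ) *Λ tl u +Λ (-Λ tl u) *Λ (a ·Λ 1Λ)
        ≈⟨ +Λ-cong (≈Λ-trans (*Λ-·Λˡ a 1Λ (tl u)) (·Λ-cong a (*Λ-identityˡ (tl u))))
                   (≈Λ-trans (*Λ-negˡ (tl u) _) (-Λ-cong (≈Λ-trans (*Λ-·Λʳ a (tl u) 1Λ) (·Λ-cong a (*Λ-identityʳ (tl u)))))) ⟩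
      a ·Λ tl u +Λ -Λ (a ·Λ tl u)
        ≈⟨ (λ U → -‿inverseʳ _) ⟩
      0Λ ∎

  -- ∂ (e₀ *Λ a +Λ b) = a -Λ e₀ *Λ ∂ a +Λ ∂ b
  ∂ : ∀ {k} → Λ k → Λ k
  ∂ {zero}  x             = 0Λ
  ∂ {suc k} x (true ∷ U)  = - ∂ (hd x) U
  ∂ {suc k} x (false ∷ U) = hd x U + ∂ (tl x) U

  ∂-cong : ∀ {k} {x y : Λ k} → x ≈Λ y → ∂ x ≈Λ ∂ y
  ∂-cong {zero}  x≈y []          = refl
  ∂-cong {suc k} x≈y (true ∷ U)  = -‿cong (∂-cong (hd-cong x≈y) U)
  ∂-cong {suc k} x≈y (false ∷ U) = +-cong (x≈y (true ∷ U)) (∂-cong (tl-cong x≈y) U)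

  ∂-+Λ : ∀ {k} (x y : Λ k) → ∂ (x +Λ y) ≈Λ ∂ x +Λ ∂ y
  ∂-+Λ {zero}  x y []          = sym (+-identityˡ 0#)
  ∂-+Λ {suc k} x y (true ∷ U)  = trans (-‿cong (∂-+Λ (hd x) (hd y) U)) (sym (-‿+-comm _ _))
  ∂-+Λ {suc k} x y (false ∷ U) = trans (+-cong refl (∂-+Λ (tl x) (tl y) U)) (+-interchange _ _ _ _)

  ∂-·Λ : ∀ {k} r (x : Λ k) → ∂ (r ·Λ x) ≈Λ r ·Λ ∂ x
  ∂-·Λ {zero}  r x []          = sym (zeroʳ r)
  ∂-·Λ {suc k} r x (true ∷ U)  = trans (-‿cong (∂-·Λ r (hd x) U)) (-‿distribʳ-* _ _)
  ∂-·Λ {suc k} r x (false ∷ U) = trans (+-cong refl (∂-·Λ r (tl x) U)) (sym (distribˡ _ _ _))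

  ∂-0Λ : ∀ {k} → ∂ (0Λ {k}) ≈Λ 0Λ
  ∂-0Λ = ≈Λ-trans (∂-cong (λ _ → sym (zeroˡ 0#))) (≈Λ-trans (∂-·Λ 0# 0Λ) (λ _ → zeroˡ _))

  ∂-neg : ∀ {k} (x : Λ k) → ∂ (-Λ x) ≈Λ -Λ ∂ x
  ∂-neg x = ≈Λ-trans (∂-cong (-Λ≈-1·Λ x)) (≈Λ-trans (∂-·Λ _ x) (≈Λ-sym (-Λ≈-1·Λ _)))

  ∂-ι : ∀ {k} (x : Λ k) → ∂ (ι x) ≈Λ -Λ ι (∂ x)
  ∂-ι {zero} x [] = sym (trans (-‿cong (zeroʳ _)) -0#≈0#)
  ∂-ι {suc k} x = ≈Λ-from-hd-tl head tail
    where
    open ≈Λ-Reasoning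
    head : hd (∂ (ι x)) ≈Λ hd (-Λ ι (∂ x))
    head = begin
      -Λ ∂ (hd (ι x))         ≈⟨ -Λ-cong (≈Λ-trans (∂-cong (hd-ι x)) (∂-neg (ι (hd x)))) ⟩
      -Λ -Λ ∂ (ι (hd x))      ≈⟨ (λ U → -‿involutive _) ⟩
      ∂ (ι (hd x))            ≈⟨ ∂-ι (hd x) ⟩
      -Λ ι (∂ (hd x))         ≈⟨ ι-neg (∂ (hd x)) ⟨
      ι (-Λ ∂ (hd x))         ≈⟨ (λ U → -‿involutive _) ⟨
      -Λ -Λ ι (-Λ ∂ (hd x))   ≈⟨ -Λ-cong (hd-ι (∂ x)) ⟨
      -Λ hd (ι (∂ x))         ∎
    tail : tl (∂ (ι x)) ≈Λ tl (-Λ ι (∂ x))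
    tail = begin
      hd (ι x) +Λ ∂ (tl (ι x))           ≈⟨ +Λ-cong (hd-ι x) (∂-ι (tl x)) ⟩
      -Λ ι (hd x) +Λ -Λ ι (∂ (tl x))     ≈⟨ -Λ-+Λ _ _ ⟨
      -Λ (ι (hd x) +Λ ι (∂ (tl x)))      ≈⟨ -Λ-cong (ι-+Λ (hd x) (∂ (tl x))) ⟨
      -Λ tl (ι (∂ x))                    ∎

  leibniz-rearrange : ∀ a b c d e → - ((a + b) + (- c + d)) ≈ (- a + (e + c)) + ((- e + - b) + - d)
  leibniz-rearrange a b c d e = begin
    - ((a + b) + (- c + d))
      ≈⟨ trans (sym (-‿+-comm _ _)) (+-cong (sym (-‿+-comm a b)) (trans (sym (-‿+-comm _ _)) (+-cong (-‿involutive c) refl))) ⟩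
    (- a + - b) + (c + - d)
      ≈⟨ +-interchange _ _ _ _ ⟩
    (- a + c) + (- b + - d)
      ≈⟨ trans (+-cong refl (-‿inverseʳ e)) (+-identityʳ _) ⟨
    (- a + c) + (- b + - d) + (e + - e)
      ≈⟨ +-Solver.solve 6 (λ a′ b′ c d′ e e′ → (((a′ ⊕ c) ⊕ (b′ ⊕ d′)) ⊕ (e ⊕ e′)) ⊜ ((a′ ⊕ (e ⊕ c)) ⊕ ((e′ ⊕ b′) ⊕ d′)))
                          refl (- a) (- b) c (- d) e (- e) ⟩
    (- a + (e + c)) + ((- e + - b) + - d) ∎
    where
    open ≈-Reasoning
    open +-Solver using (_⊕_; _⊜_)

  ∂-*Λ : ∀ {k} (x y : Λ k) → ∂ (x *Λ y) ≈Λ ∂ x *Λ y +Λ ι x *Λ ∂ y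
  ∂-*Λ {zero} x y [] =
    sym (trans (+-cong (trans (*Λ-at-[] (∂ x) y) (zeroˡ _)) (trans (*Λ-at-[] (ι x) (∂ y)) (zeroʳ _))) (+-identityˡ 0#))
  ∂-*Λ {suc k} x y = ≈Λ-from-hd-tl head tail
    where
    x₁ = hd x; x₀ = tl x; y₁ = hd y; y₀ = tl y
    head : hd (∂ (x *Λ y)) ≈Λ hd (∂ x *Λ y +Λ ι x *Λ ∂ y)
    head = begin
      -Λ ∂ (hd (x *Λ y))
        ≈⟨ -Λ-cong (≈Λ-trans (∂-cong (hd-*Λ x y)) (∂-+Λ _ _)) ⟩
      -Λ (∂ (x₁ *Λ y₀) +Λ ∂ (ι x₀ *Λ y₁))
        ≈⟨ -Λ-cong (+Λ-cong (∂-*Λ x₁ y₀) (∂-*Λ (ι x₀) y₁)) ⟩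
      -Λ ((∂ x₁ *Λ y₀ +Λ ι x₁ *Λ ∂ y₀) +Λ (∂ (ι x₀) *Λ y₁ +Λ ι (ι x₀) *Λ ∂ y₁))
        ≈⟨ -Λ-cong (+Λ-cong ≈Λ-refl (+Λ-cong (≈Λ-trans (*Λ-congˡ (∂-ι x₀)) (*Λ-negˡ _ y₁)) (*Λ-congˡ (ι-involutive x₀)))) ⟩
      -Λ ((∂ x₁ *Λ y₀ +Λ ι x₁ *Λ ∂ y₀) +Λ (-Λ (ι (∂ x₀) *Λ y₁) +Λ x₀ *Λ ∂ y₁))
        ≈⟨ (λ U → leibniz-rearrange _ _ _ _ ((ι x₁ *Λ y₁) U)) ⟩
      (-Λ (∂ x₁ *Λ y₀) +Λ (ι x₁ *Λ y₁ +Λ ι (∂ x₀) *Λ y₁)) +Λ ((-Λ (ι x₁ *Λ y₁) +Λ -Λ (ι x₁ *Λ ∂ y₀)) +Λ -Λ (x₀ *Λ ∂ y₁))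
        ≈⟨ +Λ-cong (+Λ-cong (*Λ-negˡ (∂ x₁) y₀) (≈Λ-trans (*Λ-congˡ (ι-+Λ x₁ (∂ x₀))) (*Λ-distribʳ y₁ (ι x₁) (ι (∂ x₀)))))
                   (+Λ-cong (≈Λ-trans (*Λ-negˡ (ι x₁) _) (≈Λ-trans (-Λ-cong (*Λ-distribˡ (ι x₁) y₁ (∂ y₀))) (-Λ-+Λ _ _)))
                            (*Λ-negʳ x₀ (∂ y₁))) ⟨
      ((-Λ ∂ x₁) *Λ y₀ +Λ ι (x₁ +Λ ∂ x₀) *Λ y₁) +Λ ((-Λ ι x₁) *Λ (y₁ +Λ ∂ y₀) +Λ x₀ *Λ (-Λ ∂ y₁))
        ≈⟨ +Λ-cong (hd-*Λ (∂ x) y) (≈Λ-trans (hd-*Λ (ι x) (∂ y)) (+Λ-cong (*Λ-congˡ (hd-ι x)) (*Λ-congˡ (ι-involutive x₀)))) ⟨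
      hd (∂ x *Λ y +Λ ι x *Λ ∂ y) ∎
      where open ≈Λ-Reasoning
    tail : tl (∂ (x *Λ y)) ≈Λ tl (∂ x *Λ y +Λ ι x *Λ ∂ y)
    tail = begin
      hd (x *Λ y) +Λ ∂ (tl (x *Λ y))
        ≈⟨ +Λ-cong (hd-*Λ x y) (≈Λ-trans (∂-cong (tl-*Λ x y)) (∂-*Λ x₀ y₀)) ⟩
      (x₁ *Λ y₀ +Λ ι x₀ *Λ y₁) +Λ (∂ x₀ *Λ y₀ +Λ ι x₀ *Λ ∂ y₀)
        ≈⟨ (λ U → +-interchange _ _ _ _) ⟩
      (x₁ *Λ y₀ +Λ ∂ x₀ *Λ y₀) +Λ (ι x₀ *Λ y₁ +Λ ι x₀ *Λ ∂ y₀)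
        ≈⟨ +Λ-cong (*Λ-distribʳ y₀ x₁ (∂ x₀)) (*Λ-distribˡ (ι x₀) y₁ (∂ y₀)) ⟨
      (x₁ +Λ ∂ x₀) *Λ y₀ +Λ ι x₀ *Λ (y₁ +Λ ∂ y₀)
        ≈⟨ +Λ-cong (tl-*Λ (∂ x) y) (≈Λ-trans (tl-*Λ (ι x) (∂ y)) (*Λ-congˡ (tl-ι x))) ⟨
      tl (∂ x *Λ y +Λ ι x *Λ ∂ y) ∎
      where open ≈Λ-Reasoning

  ∂-1Λ : ∀ {k} → ∂ (1Λ {k}) ≈Λ 0Λ
  ∂-1Λ {zero}  = ≈Λ-refl
  ∂-1Λ {suc k} = ≈Λ-from-hd-tl
    (λ U → trans (-‿cong (trans (∂-cong (hd-1Λ {k}) U) (∂-0Λ U))) -0#≈0#)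
    (λ U → trans (+-cong (hd-1Λ {k} U) (trans (∂-cong (tl-1Λ {k}) U) (∂-1Λ U))) (+-identityˡ 0#))

  ∂-gen : ∀ {k} (i : Fin k) → ∂ (gen i) ≈Λ 1Λ
  ∂-gen {suc k} zero = ≈Λ-from-hd-tl
    (λ U → trans (-‿cong (trans (∂-cong (hd-mono-true ∅) U) (∂-1Λ U))) (trans -0#≈0# (sym (hd-1Λ {k} U))))
    (λ U → trans (+-cong (hd-mono-true ∅ U) (trans (∂-cong (tl-mono-true ∅) U) (∂-0Λ U))) (trans (+-identityʳ _) (sym (tl-1Λ {k} U))))
  ∂-gen {suc k} (suc i) = ≈Λ-from-hd-tl
    (λ U → trans (-‿cong (trans (∂-cong (hd-mono-false ⁅ i ⁆) U) (∂-0Λ U))) (trans -0#≈0# (sym (hd-1Λ {k} U))))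
    (λ U → trans (+-cong (hd-mono-false ⁅ i ⁆ U) (trans (∂-cong (tl-mono-false ⁅ i ⁆) U) (∂-gen i U)))
                 (trans (+-identityˡ _) (sym (tl-1Λ {k} U))))

  ∂-*Λ-closed : ∀ {k} (w q : Λ k) → ∂ w ≈Λ 0Λ → ∂ q ≈Λ 1Λ → ∂ (w *Λ q) ≈Λ ι w
  ∂-*Λ-closed w q ∂w≈0 ∂q≈1 = begin
    ∂ (w *Λ q)              ≈⟨ ∂-*Λ w q ⟩
    ∂ w *Λ q +Λ ι w *Λ ∂ q  ≈⟨ +Λ-cong (≈Λ-trans (*Λ-congˡ ∂w≈0) (*Λ-zeroˡ q))
                                       (≈Λ-trans (*Λ-congʳ ∂q≈1) (*Λ-identityʳ (ι w))) ⟩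
    0Λ +Λ ι w               ≈⟨ (λ U → +-identityˡ _) ⟩
    ι w                     ∎
    where open ≈Λ-Reasoning

  prod : ∀ {k} → List (Λ k) → Λ k
  prod = foldr _*Λ_ 1Λ

  lift : ∀ {k} → Λ k → Λ (suc k)
  lift x (true ∷ S)  = 0#
  lift x (false ∷ S) = x S

  lift-cong : ∀ {k} {x y : Λ k} → x ≈Λ y → lift x ≈Λ lift y
  lift-cong x≈y (true ∷ S)  = refl
  lift-cong x≈y (false ∷ S) = x≈y S

  lift-*Λ : ∀ {k} (x y : Λ k) → lift x *Λ lift y ≈Λ lift (x *Λ y)
  lift-*Λ x y = ≈Λ-from-hd-tl
    (≈Λ-trans (hd-*Λ (lift x) (lift y)) (λ U → trans (+-cong (*Λ-zeroˡ y U) (*Λ-zeroʳ (ι x) U)) (+-identityˡ 0#)))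
    (tl-*Λ (lift x) (lift y))

  lift-1Λ : ∀ {k} → lift (1Λ {k}) ≈Λ 1Λ
  lift-1Λ {k} = ≈Λ-from-hd-tl (≈Λ-sym (hd-1Λ {k})) (≈Λ-sym (tl-1Λ {k}))

  mono-false≈lift : ∀ {k} (S : Subset k) → mono (false ∷ S) ≈Λ lift (mono S)
  mono-false≈lift S = ≈Λ-from-hd-tl (hd-mono-false S) (tl-mono-false S)

  gen₀*Λlift-mono : ∀ {k} (S : Subset k) → gen zero *Λ lift (mono S) ≈Λ mono (true ∷ S)
  gen₀*Λlift-mono S = ≈Λ-from-hd-tl head tail
    where
    open ≈Λ-Reasoning
    head : hd (gen zero *Λ lift (mono S)) ≈Λ hd (mono (true ∷ S))
    head = begin
      hd (gen zero *Λ lift (mono S))                        ≈⟨ hd-*Λ (gen zero) (lift (mono S)) ⟩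
      hd (gen zero) *Λ mono S +Λ ι (tl (gen zero)) *Λ 0Λ    ≈⟨ +Λ-cong (*Λ-congˡ (hd-mono-true ∅)) (*Λ-zeroʳ _) ⟩
      1Λ *Λ mono S +Λ 0Λ                                    ≈⟨ (λ U → trans (+-identityʳ _) (*Λ-identityˡ (mono S) U)) ⟩
      mono S                                                ≈⟨ hd-mono-true S ⟨
      hd (mono (true ∷ S))                                  ∎
    tail : tl (gen zero *Λ lift (mono S)) ≈Λ tl (mono (true ∷ S))
    tail = begin
      tl (gen zero *Λ lift (mono S))   ≈⟨ tl-*Λ (gen zero) (lift (mono S)) ⟩
      tl (gen zero) *Λ mono S          ≈⟨ ≈Λ-trans (*Λ-congˡ (tl-mono-true ∅)) (*Λ-zeroˡ (mono S)) ⟩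
      0Λ                               ≈⟨ tl-mono-true S ⟨
      tl (mono (true ∷ S))             ∎

  prod-gen-map-suc : ∀ {k} (is : List (Fin k)) → prod (map gen (map suc is)) ≈Λ lift (prod (map gen is))
  prod-gen-map-suc []       = ≈Λ-sym lift-1Λ
  prod-gen-map-suc (i ∷ is) = ≈Λ-trans (*Λ-cong (mono-false≈lift ⁅ i ⁆) (prod-gen-map-suc is)) (lift-*Λ (gen i) _)

  prod-gen-elems : ∀ {k} (S : Subset k) → prod (map gen (elems S)) ≈Λ mono S
  prod-gen-elems {zero}  []          = ≈Λ-refl
  prod-gen-elems {suc k} (true ∷ S)  =
    ≈Λ-trans (*Λ-congʳ (≈Λ-trans (prod-gen-map-suc (elems S)) (lift-cong (prod-gen-elems S)))) (gen₀*Λlift-mono S)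
  prod-gen-elems {suc k} (false ∷ S) =
    ≈Λ-trans (prod-gen-map-suc (elems S)) (≈Λ-trans (lift-cong (prod-gen-elems S)) (≈Λ-sym (mono-false≈lift S)))

  ΣL-neg : ∀ {a} {A : Set a} (xs : List A) (f : A → R) → ΣL xs (λ x → - f x) ≈ - ΣL xs f
  ΣL-neg []       f = sym -0#≈0#
  ΣL-neg (x ∷ xs) f = trans (+-cong refl (ΣL-neg xs f)) (-‿+-comm _ _)

  ∂mono≈∂-mono : ∀ {k} (S : Subset k) → ∂mono S ≈Λ ∂ (mono S)
  ∂mono≈∂-mono {zero}  [] [] = refl
  ∂mono≈∂-mono {suc k} (b ∷ S) (u ∷ U) =
    trans (reflexive (ΣL-allFin-suc k (term (b ∷ S) (u ∷ U)))) (split b u)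
    where
    term : ∀ {j} → Subset j → Subset j → Fin j → R
    term S U i = when (lookup S i) (sgn (below i S) * mono (S ∖ i) U)
    rest : Bool → Bool → R
    rest b u = ΣL (allFin k) (term (b ∷ S) (u ∷ U) ∘ suc)
    split : ∀ b u → term (b ∷ S) (u ∷ U) zero + rest b u ≈ ∂ (mono (b ∷ S)) (u ∷ U)
    split true true = begin
      1# * mono (false ∷ (S ─ ∅)) (true ∷ U) + rest true true
        ≈⟨ +-cong (trans (*-cong refl (hd-mono-false (S ─ ∅) U)) (zeroʳ 1#))
                  (ΣL-cong (allFin k) λ j → trans (when-cong (lookup S j) (trans (*-cong refl (hd-mono-true (S ∖ j) U)) (sym (-‿distribˡ-* _ _))))
                                                  (when-neg (lookup S j) _)) ⟩
      0# + ΣL (allFin k) (λ j → - term S U j)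
        ≈⟨ trans (+-identityˡ _) (ΣL-neg (allFin k) (term S U)) ⟩
      - ∂mono S U
        ≈⟨ -‿cong (trans (∂mono≈∂-mono S U) (∂-cong (≈Λ-sym (hd-mono-true S)) U)) ⟩
      ∂ (mono (true ∷ S)) (true ∷ U) ∎
      where open ≈-Reasoning
    split true false = begin
      1# * mono (false ∷ (S ─ ∅)) (false ∷ U) + rest true false
        ≈⟨ +-cong (trans (*-identityˡ _) (trans (tl-mono-false (S ─ ∅) U) (reflexive (P.cong (λ S′ → mono S′ U) (p─⊥≡p S)))))
                  (ΣL-zero (allFin k) λ j → when-zero (lookup S j) (trans (*-cong refl (tl-mono-true (S ∖ j) U)) (zeroʳ _))) ⟩
      mono S U + 0#
        ≈⟨ +-cong (hd-mono-true S U) (trans (∂-cong (tl-mono-true S) U) (∂-0Λ U)) ⟨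
      ∂ (mono (true ∷ S)) (false ∷ U) ∎
      where open ≈-Reasoning
    split false true = begin
      0# + rest false true
        ≈⟨ +-cong refl (ΣL-zero (allFin k) λ j → when-zero (lookup S j) (trans (*-cong refl (hd-mono-false (S ∖ j) U)) (zeroʳ _))) ⟩
      0# + 0#
        ≈⟨ trans (+-identityˡ 0#) (sym -0#≈0#) ⟩
      - 0#
        ≈⟨ -‿cong (trans (∂-cong (hd-mono-false S) U) (∂-0Λ U)) ⟨
      ∂ (mono (false ∷ S)) (true ∷ U) ∎
      where open ≈-Reasoning
    split false false = begin
      0# + rest false false
        ≈⟨ +-cong refl (ΣL-cong (allFin k) λ j → when-cong (lookup S j) (*-cong refl (tl-mono-false (S ∖ j) U))) ⟩
      0# + ∂mono S U
        ≈⟨ +-cong refl (trans (∂mono≈∂-mono S U) (∂-cong (≈Λ-sym (tl-mono-false S)) U)) ⟩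
      0# + ∂ (tl (mono (false ∷ S))) U
        ≈⟨ +-cong (hd-mono-false S U) refl ⟨
      ∂ (mono (false ∷ S)) (false ∷ U) ∎
      where open ≈-Reasoning

  mono-*Λ-disjoint : ∀ {k} (A B : Subset k) → disjointᵇ A B ≡ true → mono A *Λ mono B ≈Λ sgn (inv A B) ·Λ mono (A ∪ B)
  mono-*Λ-disjoint {k} A B A∩B≡∅ U = begin
    (mono A *Λ mono B) U
      ≈⟨ ΣL-allSubsets-point A _ (λ S S≢A → ΣL-zero (allSubsets k) λ T → when-zero (disjointᵇ S T ∧ eqᵇ (S ∪ T) U)
                                   (trans (*-cong refl (trans (*-cong (mono-≢ S≢A) refl) (zeroˡ _))) (zeroʳ _))) ⟩
    ΣL (allSubsets k) (λ T → when (disjointᵇ A T ∧ eqᵇ (A ∪ T) U) (sgn (inv A T) * (mono A A * mono B T)))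
      ≈⟨ ΣL-allSubsets-point B _ (λ T T≢B → when-zero (disjointᵇ A T ∧ eqᵇ (A ∪ T) U)
                                   (trans (*-cong refl (trans (*-cong refl (mono-≢ T≢B)) (zeroʳ _))) (zeroʳ _))) ⟩
    when (disjointᵇ A B ∧ eqᵇ (A ∪ B) U) (sgn (inv A B) * (mono A A * mono B B))
      ≈⟨ reflexive (P.cong (λ d → when (d ∧ eqᵇ (A ∪ B) U) (sgn (inv A B) * (mono A A * mono B B))) A∩B≡∅) ⟩
    when (eqᵇ (A ∪ B) U) (sgn (inv A B) * (mono A A * mono B B))
      ≈⟨ when-cong (eqᵇ (A ∪ B) U) (trans (*-cong refl (trans (*-cong (mono-refl A) (mono-refl B)) (*-identityˡ 1#))) (*-identityʳ _)) ⟩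
    when (eqᵇ (A ∪ B) U) (sgn (inv A B))
      ≈⟨ trans (when-cong (eqᵇ (A ∪ B) U) (sym (*-identityʳ _))) (when-*ˡ (eqᵇ (A ∪ B) U) _ 1#) ⟩
    sgn (inv A B) * when (eqᵇ (A ∪ B) U) 1#
      ≈⟨ reflexive (P.cong (λ b → sgn (inv A B) * when b 1#) (eqᵇ-sym (A ∪ B) U)) ⟩
    (sgn (inv A B) ·Λ mono (A ∪ B)) U ∎
    where open ≈-Reasoning

  monoImage : ∀ {k k′} → (Fin k → Λ k′) → Subset k → Λ k′
  monoImage f S = prod (map f (elems S))

  monoImage-true : ∀ {k k′} (f : Fin (suc k) → Λ k′) (S : Subset k) → monoImage f (true ∷ S) ≡ f zero *Λ monoImage (f ∘ suc) S
  monoImage-true f S = P.cong (λ l → f zero *Λ prod l) (P.sym (map-∘ (elems S)))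

  monoImage-false : ∀ {k k′} (f : Fin (suc k) → Λ k′) (S : Subset k) → monoImage f (false ∷ S) ≡ monoImage (f ∘ suc) S
  monoImage-false f S = P.cong prod (P.sym (map-∘ (elems S)))

  combination : ∀ {k k′} → List (Subset k) → (Subset k → R) → (Subset k → Λ k′) → Λ k′
  combination Ss r G U = ΣL Ss (λ S → r S * G S U)

  *Λ-combination : ∀ {k k′} (a : Λ k′) (Ss : List (Subset k)) r G → a *Λ combination Ss r G ≈Λ combination Ss r (λ S → a *Λ G S)
  *Λ-combination a []       r G = *Λ-zeroʳ a
  *Λ-combination a (S ∷ Ss) r G U =
    trans (*Λ-distribˡ a (r S ·Λ G S) (combination Ss r G) U) (+-cong (*Λ-·Λʳ (r S) a (G S) U) (*Λ-combination a Ss r G U))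

  module _ {k′ : ℕ} where

    extend-cong : ∀ {k} (f : Fin k → Λ k′) {x y : Λ k} → x ≈Λ y → extend f x ≈Λ extend f y
    extend-cong {k} f x≈y U = ΣL-cong (allSubsets k) λ S → *-cong (x≈y S) refl

    extend-+Λ : ∀ {k} (f : Fin k → Λ k′) (x y : Λ k) → extend f (x +Λ y) ≈Λ extend f x +Λ extend f y
    extend-+Λ {k} f x y U = trans (ΣL-cong (allSubsets k) λ S → distribʳ _ _ _) (ΣL-+ (allSubsets k) _ _)

    extend-·Λ : ∀ {k} (f : Fin k → Λ k′) r (x : Λ k) → extend f (r ·Λ x) ≈Λ r ·Λ extend f x
    extend-·Λ {k} f r x U = trans (ΣL-cong (allSubsets k) λ S → *-assoc _ _ _) (sym (ΣL-*ˡ (allSubsets k) r _))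

    extend-0Λ : ∀ {k} (f : Fin k → Λ k′) → extend f 0Λ ≈Λ 0Λ
    extend-0Λ {k} f U = ΣL-zero (allSubsets k) λ S → zeroˡ _

    extend-neg : ∀ {k} (f : Fin k → Λ k′) (x : Λ k) → extend f (-Λ x) ≈Λ -Λ extend f x
    extend-neg f x = ≈Λ-trans (extend-cong f (-Λ≈-1·Λ x)) (≈Λ-trans (extend-·Λ f _ x) (≈Λ-sym (-Λ≈-1·Λ _)))

    extend-mono : ∀ {k} (f : Fin k → Λ k′) (A : Subset k) → extend f (mono A) ≈Λ monoImage f A
    extend-mono f A U = trans (ΣL-allSubsets-point A _ (λ S S≢A → trans (*-cong (mono-≢ S≢A) refl) (zeroˡ _)))
                              (trans (*-cong (mono-refl A) refl) (*-identityˡ _))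

    extend-1Λ : ∀ {k} (f : Fin k → Λ k′) → extend f 1Λ ≈Λ 1Λ
    extend-1Λ {k} f = ≈Λ-trans (extend-mono f ∅) (≈Λ-reflexive (P.cong (prod ∘ map f) (elems-∅ {k})))

    extend-gen : ∀ {k} (f : Fin k → Λ k′) (i : Fin k) → extend f (gen i) ≈Λ f i
    extend-gen f i =
      ≈Λ-trans (extend-mono f ⁅ i ⁆) (≈Λ-trans (≈Λ-reflexive (P.cong (prod ∘ map f) (elems-⁅⁆ i))) (*Λ-identityʳ (f i)))

    extend-[] : (f : Fin 0 → Λ k′) (x : Λ 0) → extend f x ≈Λ x [] ·Λ 1Λ
    extend-[] f x U = +-identityʳ _

    extend-hd-tl : ∀ {k} (f : Fin (suc k) → Λ k′) (x : Λ (suc k)) →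
                   extend f x ≈Λ f zero *Λ extend (f ∘ suc) (hd x) +Λ extend (f ∘ suc) (tl x)
    extend-hd-tl {k} f x U = trans (ΣL-allSubsets-suc k _) (+-cong
      (trans (ΣL-cong (allSubsets k) λ S → *-cong refl (reflexive (P.cong (λ z → z U) (monoImage-true f S))))
             (sym (*Λ-combination (f zero) (allSubsets k) (hd x) (monoImage (f ∘ suc)) U)))
      (ΣL-cong (allSubsets k) λ S → *-cong refl (reflexive (P.cong (λ z → z U) (monoImage-false f S)))))

  *Λ-Linear-comm : ∀ {k} {u : Λ k} → Linear u → ∀ x → x *Λ u ≈Λ u *Λ ι x
  *Λ-Linear-comm lu x = ≈Λ-sym (≈Λ-trans (Linear-*Λ-comm lu (ι x)) (*Λ-congˡ (ι-involutive x)))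

  Linear-*Λ-past : ∀ {k} {u : Λ k} → Linear u → ∀ x y → x *Λ (u *Λ y) ≈Λ u *Λ (ι x *Λ y)
  Linear-*Λ-past {u = u} lu x y = begin
    x *Λ (u *Λ y)      ≈⟨ *Λ-assoc x u y ⟨
    (x *Λ u) *Λ y      ≈⟨ *Λ-congˡ (*Λ-Linear-comm lu x) ⟩
    (u *Λ ι x) *Λ y    ≈⟨ *Λ-assoc u (ι x) y ⟩
    u *Λ (ι x *Λ y)    ∎
    where open ≈Λ-Reasoning

  Linear-*Λ-twice : ∀ {k} {u : Λ k} → Linear u → ∀ x y → (u *Λ x) *Λ (u *Λ y) ≈Λ 0Λ
  Linear-*Λ-twice {u = u} lu x y = begin
    (u *Λ x) *Λ (u *Λ y)       ≈⟨ *Λ-assoc u x (u *Λ y) ⟩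
    u *Λ (x *Λ (u *Λ y))       ≈⟨ *Λ-congʳ (Linear-*Λ-past lu x y) ⟩
    u *Λ (u *Λ (ι x *Λ y))     ≈⟨ *Λ-assoc u u _ ⟨
    (u *Λ u) *Λ (ι x *Λ y)     ≈⟨ ≈Λ-trans (*Λ-congˡ (Linear-square lu)) (*Λ-zeroˡ _) ⟩
    0Λ                         ∎
    where open ≈Λ-Reasoning

  Linear-*Λ-sandwich : ∀ {k} {u : Λ k} → Linear u → ∀ x → u *Λ (x *Λ u) ≈Λ 0Λ
  Linear-*Λ-sandwich {u = u} lu x = begin
    u *Λ (x *Λ u)       ≈⟨ *Λ-assoc u x u ⟨
    (u *Λ x) *Λ u       ≈⟨ *Λ-congˡ (Linear-*Λ-comm lu x) ⟩
    (ι x *Λ u) *Λ u     ≈⟨ *Λ-assoc (ι x) u u ⟩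
    ι x *Λ (u *Λ u)     ≈⟨ ≈Λ-trans (*Λ-congʳ (Linear-square lu)) (*Λ-zeroʳ (ι x)) ⟩
    0Λ                  ∎
    where open ≈Λ-Reasoning

  module _ {k′ : ℕ} where

    extend-ι : ∀ {k} (f : Fin k → Λ k′) → (∀ i → Linear (f i)) → ∀ x → ι (extend f x) ≈Λ extend f (ι x)
    extend-ι {zero} f _ x = begin
      ι (extend f x)        ≈⟨ ι-cong (extend-[] f x) ⟩
      ι (x [] ·Λ 1Λ)        ≈⟨ ≈Λ-trans (ι-·Λ (x []) 1Λ) (·Λ-cong (x []) ι-1Λ) ⟩
      x [] ·Λ 1Λ            ≈⟨ (λ U → *-cong (sym (*-identityˡ (x []))) refl) ⟩
      ι x [] ·Λ 1Λ          ≈⟨ extend-[] f (ι x) ⟨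
      extend f (ι x)        ∎
      where open ≈Λ-Reasoning
    extend-ι {suc k} f lin x = begin
      ι (extend f x)
        ≈⟨ ι-cong (extend-hd-tl f x) ⟩
      ι (f zero *Λ E (hd x) +Λ E (tl x))
        ≈⟨ ≈Λ-trans (ι-+Λ _ _) (+Λ-cong (ι-*Λ (f zero) _) (extend-ι g (lin ∘ suc) (tl x))) ⟩
      ι (f zero) *Λ ι (E (hd x)) +Λ E (ι (tl x))
        ≈⟨ +Λ-cong (*Λ-cong (ι-Linear (lin zero)) (extend-ι g (lin ∘ suc) (hd x))) ≈Λ-refl ⟩
      (-Λ f zero) *Λ E (ι (hd x)) +Λ E (ι (tl x))
        ≈⟨ +Λ-cong (≈Λ-trans (*Λ-negˡ _ _) (≈Λ-sym (*Λ-negʳ _ _))) ≈Λ-refl ⟩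
      f zero *Λ (-Λ E (ι (hd x))) +Λ E (ι (tl x))
        ≈⟨ +Λ-cong (*Λ-congʳ (≈Λ-trans (extend-cong g (hd-ι x)) (extend-neg g _))) (extend-cong g (tl-ι x)) ⟨
      f zero *Λ E (hd (ι x)) +Λ E (tl (ι x))
        ≈⟨ extend-hd-tl f (ι x) ⟨
      extend f (ι x) ∎
      where
      open ≈Λ-Reasoning
      g = f ∘ suc
      E = extend g

    extend-*Λ : ∀ {k} (f : Fin k → Λ k′) → (∀ i → Linear (f i)) → ∀ x y → extend f (x *Λ y) ≈Λ extend f x *Λ extend f y
    extend-*Λ {zero} f _ x y = begin
      extend f (x *Λ y)                     ≈⟨ extend-[] f (x *Λ y) ⟩
      (x *Λ y) [] ·Λ 1Λ                     ≈⟨ (λ U → trans (*-cong (*Λ-at-[] x y) refl) (*-assoc _ _ _)) ⟩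
      x [] ·Λ y [] ·Λ 1Λ                    ≈⟨ ·Λ-cong (x []) (*Λ-identityˡ _) ⟨
      x [] ·Λ (1Λ *Λ (y [] ·Λ 1Λ))          ≈⟨ *Λ-·Λˡ (x []) 1Λ _ ⟨
      (x [] ·Λ 1Λ) *Λ (y [] ·Λ 1Λ)          ≈⟨ *Λ-cong (extend-[] f x) (extend-[] f y) ⟨
      extend f x *Λ extend f y              ∎
      where open ≈Λ-Reasoning
    extend-*Λ {suc k} f lin x y = begin
      extend f (x *Λ y)
        ≈⟨ extend-hd-tl f (x *Λ y) ⟩
      u *Λ E (hd (x *Λ y)) +Λ E (tl (x *Λ y))
        ≈⟨ +Λ-cong (*Λ-congʳ (≈Λ-trans (extend-cong g (hd-*Λ x y)) (≈Λ-trans (extend-+Λ g _ _) (+Λ-cong (IH x₁ y₀) (IH (ι x₀) y₁)))))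
                   (≈Λ-trans (extend-cong g (tl-*Λ x y)) (IH x₀ y₀)) ⟩
      u *Λ (E x₁ *Λ E y₀ +Λ E (ι x₀) *Λ E y₁) +Λ E x₀ *Λ E y₀
        ≈⟨ +Λ-cong (*Λ-distribˡ u _ _) ≈Λ-refl ⟩
      u *Λ (E x₁ *Λ E y₀) +Λ u *Λ (E (ι x₀) *Λ E y₁) +Λ E x₀ *Λ E y₀
        ≈⟨ (λ U → trans (+-assoc _ _ _) (+-cong (sym (+-identityˡ _)) refl)) ⟩
      0Λ +Λ u *Λ (E x₁ *Λ E y₀) +Λ (u *Λ (E (ι x₀) *Λ E y₁) +Λ E x₀ *Λ E y₀)
        ≈⟨ +Λ-cong (+Λ-cong (Linear-*Λ-twice (lin zero) (E x₁) (E y₁)) (*Λ-assoc u (E x₁) (E y₀)))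
                   (+Λ-cong (≈Λ-trans (Linear-*Λ-past (lin zero) (E x₀) (E y₁)) (*Λ-congʳ (*Λ-congˡ (extend-ι g (lin ∘ suc) x₀)))) ≈Λ-refl) ⟨
      (u *Λ E x₁) *Λ (u *Λ E y₁) +Λ (u *Λ E x₁) *Λ E y₀ +Λ (E x₀ *Λ (u *Λ E y₁) +Λ E x₀ *Λ E y₀)
        ≈⟨ ≈Λ-trans (*Λ-distribʳ _ (u *Λ E x₁) (E x₀)) (+Λ-cong (*Λ-distribˡ _ _ _) (*Λ-distribˡ _ _ _)) ⟨
      (u *Λ E x₁ +Λ E x₀) *Λ (u *Λ E y₁ +Λ E y₀)
        ≈⟨ *Λ-cong (extend-hd-tl f x) (extend-hd-tl f y) ⟨
      extend f x *Λ extend f y ∎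
      where
      open ≈Λ-Reasoning
      u = f zero
      g = f ∘ suc
      E = extend g
      IH = extend-*Λ g (lin ∘ suc)
      x₁ = hd x; x₀ = tl x; y₁ = hd y; y₀ = tl y

    extend-∂ : ∀ {k} (f : Fin k → Λ k′) → (∀ i → Linear (f i)) → (∀ i → ∂ (f i) ≈Λ 1Λ) →
               ∀ x → ∂ (extend f x) ≈Λ extend f (∂ x)
    extend-∂ {zero} f _ _ x = begin
      ∂ (extend f x)     ≈⟨ ∂-cong (extend-[] f x) ⟩
      ∂ (x [] ·Λ 1Λ)     ≈⟨ ∂-·Λ (x []) 1Λ ⟩
      x [] ·Λ ∂ 1Λ       ≈⟨ (λ U → trans (*-cong refl (∂-1Λ U)) (zeroʳ _)) ⟩
      0Λ                 ≈⟨ extend-0Λ f ⟨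
      extend f (∂ x)     ∎
      where open ≈Λ-Reasoning
    extend-∂ {suc k} f lin ∂f≈1 x = begin
      ∂ (extend f x)
        ≈⟨ ≈Λ-trans (∂-cong (extend-hd-tl f x)) (∂-+Λ _ _) ⟩
      ∂ (u *Λ E x₁) +Λ ∂ (E x₀)
        ≈⟨ +Λ-cong (∂-*Λ u (E x₁)) (IH x₀) ⟩
      ∂ u *Λ E x₁ +Λ ι u *Λ ∂ (E x₁) +Λ E (∂ x₀)
        ≈⟨ +Λ-cong (+Λ-cong (≈Λ-trans (*Λ-congˡ (∂f≈1 zero)) (*Λ-identityˡ (E x₁)))
                            (≈Λ-trans (*Λ-cong (ι-Linear (lin zero)) (IH x₁)) (*Λ-negˡ u _))) ≈Λ-refl ⟩
      E x₁ +Λ -Λ (u *Λ E (∂ x₁)) +Λ E (∂ x₀)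
        ≈⟨ (λ U → +-Solver.solve 3 (λ a b c → ((a ⊕ b) ⊕ c) ⊜ (b ⊕ (a ⊕ c))) refl _ _ _) ⟩
      -Λ (u *Λ E (∂ x₁)) +Λ (E x₁ +Λ E (∂ x₀))
        ≈⟨ +Λ-cong (≈Λ-trans (*Λ-congʳ (extend-neg g (∂ x₁))) (*Λ-negʳ u _)) (extend-+Λ g x₁ (∂ x₀)) ⟨
      u *Λ E (-Λ ∂ x₁) +Λ E (x₁ +Λ ∂ x₀)
        ≈⟨ extend-hd-tl f (∂ x) ⟨
      extend f (∂ x) ∎
      where
      open ≈Λ-Reasoning
      open +-Solver using (_⊕_; _⊜_)
      u = f zero
      g = f ∘ suc
      E = extend g
      IH = extend-∂ g (lin ∘ suc) (∂f≈1 ∘ suc)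
      x₁ = hd x; x₀ = tl x

  basis-expansion : ∀ {k} (x : Λ k) → combination (allSubsets k) x mono ≈Λ x
  basis-expansion {k} x U = trans (ΣL-allSubsets-point U _ (λ S S≢U → trans (*-cong refl (mono-≢ (S≢U ∘ P.sym))) (zeroʳ _)))
                                  (trans (*-cong refl (mono-refl U)) (*-identityʳ _))

  Homog-*Λ : ∀ {k} a b (x y : Λ k) → Homog a x → Homog b y → Homog (a ℕ.+ b) (x *Λ y)
  Homog-*Λ {k} a b x y hx hy U ∣U∣≢a+b = ΣΣ-zero k term
    where
    term : ∀ S T → when (disjointᵇ S T ∧ eqᵇ (S ∪ T) U) (sgn (inv S T) * (x S * y T)) ≈ 0#
    term S T with disjointᵇ S T ∧ eqᵇ (S ∪ T) U in eq
    ... | false = refl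
    ... | true with ∧-true⁻ eq
    ... | S∩T≡∅ , S∪T≡U with ∣ S ∣ ≟ℕ a
    ... | no ∣S∣≢a = trans (*-cong refl (trans (*-cong (hx S ∣S∣≢a) refl) (zeroˡ _))) (zeroʳ _)
    ... | yes ∣S∣≡a = trans (*-cong refl (trans (*-cong refl (hy T ∣T∣≢b)) (zeroʳ _))) (zeroʳ _)
      where
      ∣T∣≢b : ¬ (∣ T ∣ ≡ b)
      ∣T∣≢b ∣T∣≡b = ∣U∣≢a+b (P.trans (P.cong ∣_∣ (P.sym (eqᵇ⇒≡ S∪T≡U)))
                                    (P.trans (∣∪∣-disjoint S T S∩T≡∅) (P.cong₂ ℕ._+_ ∣S∣≡a ∣T∣≡b)))

  Homog-1Λ : ∀ {k} → Homog 0 (1Λ {k})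
  Homog-1Λ {k} S ∣S∣≢0 = mono-≢ (λ S≡∅ → ∣S∣≢0 (P.trans (P.cong ∣_∣ S≡∅) (∣⊥∣≡0 k)))

  Linear⇒Homog₁ : ∀ {k} {u : Λ k} → Linear u → Homog 1 u
  Linear⇒Homog₁ (linear-[] u≈0) [] _ = u≈0
  Linear⇒Homog₁ (linear-∷ a hd-u _) (true ∷ S) ∣S∣≢0 =
    trans (hd-u S) (trans (*-cong refl (Homog-1Λ S (∣S∣≢0 ∘ P.cong suc))) (zeroʳ a))
  Linear⇒Homog₁ (linear-∷ _ _ tl-u) (false ∷ S) ∣S∣≢1 = Linear⇒Homog₁ tl-u S ∣S∣≢1

  module _ {k′ : ℕ} where

    Homog-prod : ∀ {k} (f : Fin k → Λ k′) → (∀ i → Linear (f i)) → ∀ (is : List (Fin k)) → Homog (length is) (prod (map f is))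
    Homog-prod f lin []       = Homog-1Λ
    Homog-prod f lin (i ∷ is) = Homog-*Λ 1 (length is) (f i) _ (Linear⇒Homog₁ (lin i)) (Homog-prod f lin is)

    extend-Homog : ∀ {k} (f : Fin k → Λ k′) → (∀ i → Linear (f i)) → ∀ d x → Homog d x → Homog d (extend f x)
    extend-Homog {k} f lin d x hx U ∣U∣≢d = ΣL-zero (allSubsets k) term
      where
      term : ∀ S → x S * monoImage f S U ≈ 0#
      term S with ∣ S ∣ ≟ℕ d
      ... | no ∣S∣≢d  = trans (*-cong (hx S ∣S∣≢d) refl) (zeroˡ _)
      ... | yes ∣S∣≡d = trans (*-cong refl (Homog-prod f lin (elems S) U ∣U∣≢length)) (zeroʳ _)
        where
        ∣U∣≢length : ¬ (∣ U ∣ ≡ length (elems S))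
        ∣U∣≢length ∣U∣≡ = ∣U∣≢d (P.trans ∣U∣≡ (P.trans (length-elems S) ∣S∣≡d))

  module _ {k} {Circ : Subset k → Set} where

    InIdeal-*Λ-*Λ : ∀ {x} → InIdeal Circ x → ∀ a b → InIdeal Circ ((a *Λ x) *Λ b)
    InIdeal-*Λ-*Λ (gen-mem {C} C-circ a′ b′) a b = resp-mem reassociate (gen-mem C-circ (a *Λ a′) (b′ *Λ b))
      where
      open ≈Λ-Reasoning
      reassociate : ((a *Λ a′) *Λ ∂mono C) *Λ (b′ *Λ b) ≈Λ (a *Λ ((a′ *Λ ∂mono C) *Λ b′)) *Λ b
      reassociate = begin
        ((a *Λ a′) *Λ ∂mono C) *Λ (b′ *Λ b)   ≈⟨ *Λ-congˡ (*Λ-assoc a a′ (∂mono C)) ⟩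
        (a *Λ (a′ *Λ ∂mono C)) *Λ (b′ *Λ b)   ≈⟨ *Λ-assoc _ b′ b ⟨
        ((a *Λ (a′ *Λ ∂mono C)) *Λ b′) *Λ b   ≈⟨ *Λ-congˡ (*Λ-assoc a _ b′) ⟩
        (a *Λ ((a′ *Λ ∂mono C) *Λ b′)) *Λ b   ∎
    InIdeal-*Λ-*Λ zero-mem a b =
      resp-mem (≈Λ-sym (≈Λ-trans (*Λ-congˡ (*Λ-zeroʳ a)) (*Λ-zeroˡ b))) zero-mem
    InIdeal-*Λ-*Λ (add-mem {x} {y} x∈I y∈I) a b =
      resp-mem (≈Λ-sym (≈Λ-trans (*Λ-congˡ (*Λ-distribˡ a x y)) (*Λ-distribʳ b (a *Λ x) (a *Λ y))))
               (add-mem (InIdeal-*Λ-*Λ x∈I a b) (InIdeal-*Λ-*Λ y∈I a b))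
    InIdeal-*Λ-*Λ (resp-mem x≈y x∈I) a b = resp-mem (*Λ-congˡ (*Λ-congʳ x≈y)) (InIdeal-*Λ-*Λ x∈I a b)

    InIdeal-·Λ-∂mono : ∀ {C} → Circ C → ∀ r → InIdeal Circ (r ·Λ ∂mono C)
    InIdeal-·Λ-∂mono {C} C-circ r = resp-mem
      (≈Λ-trans (*Λ-identityʳ _) (≈Λ-trans (*Λ-·Λˡ r 1Λ (∂mono C)) (·Λ-cong r (*Λ-identityˡ (∂mono C)))))
      (gen-mem C-circ (r ·Λ 1Λ) 1Λ)

    InIdeal-∂mono : ∀ {C} → Circ C → InIdeal Circ (∂mono C)
    InIdeal-∂mono C-circ = resp-mem (λ U → *-identityˡ _) (InIdeal-·Λ-∂mono C-circ 1#)

    ≈Λ⇒InIdeal-difference : ∀ {x y} → x ≈Λ y → InIdeal Circ (y -Λ x)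
    ≈Λ⇒InIdeal-difference x≈y = resp-mem (λ U → sym (trans (+-cong (sym (x≈y U)) refl) (-‿inverseʳ _))) zero-mem

  extend-InIdeal : ∀ {k k′} {Circ : Subset k → Set} {Circ′ : Subset k′ → Set} (f : Fin k → Λ k′) → (∀ i → Linear (f i)) →
    (∀ {C} → Circ C → InIdeal Circ′ (extend f (∂mono C))) → ∀ {x} → InIdeal Circ x → InIdeal Circ′ (extend f x)
  extend-InIdeal f lin gens (gen-mem {C} C-circ a b) = resp-mem
    (≈Λ-sym (≈Λ-trans (extend-*Λ f lin (a *Λ ∂mono C) b) (*Λ-congˡ (extend-*Λ f lin a (∂mono C)))))
    (InIdeal-*Λ-*Λ (gens C-circ) (extend f a) (extend f b))
  extend-InIdeal f lin gens zero-mem = resp-mem (≈Λ-sym (extend-0Λ f)) zero-mem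
  extend-InIdeal f lin gens (add-mem {x} {y} x∈I y∈I) =
    resp-mem (≈Λ-sym (extend-+Λ f x y)) (add-mem (extend-InIdeal f lin gens x∈I) (extend-InIdeal f lin gens y∈I))
  extend-InIdeal f lin gens (resp-mem x≈y x∈I) = resp-mem (extend-cong f x≈y) (extend-InIdeal f lin gens x∈I)

  module _ {k k′ : ℕ} (f : Fin k → Λ k′) where

    InImage : Λ k′ → Set (c ⊔ ℓ)
    InImage y = Σ (Λ k) λ x → extend f x ≈Λ y

    InImage-cong : ∀ {y y′} → y ≈Λ y′ → InImage y → InImage y′
    InImage-cong y≈y′ (x , fx≈y) = x , ≈Λ-trans fx≈y y≈y′

    InImage-+Λ : ∀ {y y′} → InImage y → InImage y′ → InImage (y +Λ y′)
    InImage-+Λ (x , fx≈y) (x′ , fx′≈y′) = x +Λ x′ , ≈Λ-trans (extend-+Λ f x x′) (+Λ-cong fx≈y fx′≈y′)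

    InImage-·Λ : ∀ r {y} → InImage y → InImage (r ·Λ y)
    InImage-·Λ r (x , fx≈y) = r ·Λ x , ≈Λ-trans (extend-·Λ f r x) (·Λ-cong r fx≈y)

    InImage-neg : ∀ {y} → InImage y → InImage (-Λ y)
    InImage-neg y∈ = InImage-cong (≈Λ-sym (-Λ≈-1·Λ _)) (InImage-·Λ _ y∈)

    InImage-f : ∀ i → InImage (f i)
    InImage-f i = gen i , extend-gen f i

    extend-surjective : (∀ i → Linear (f i)) → (∀ t → InImage (gen t)) → ∀ y → InImage y
    extend-surjective lin gen∈ y = InImage-cong (basis-expansion y) (combination∈ (allSubsets k′))
      where
      *Λ∈ : ∀ {y y′} → InImage y → InImage y′ → InImage (y *Λ y′)
      *Λ∈ (x , fx≈y) (x′ , fx′≈y′) = x *Λ x′ , ≈Λ-trans (extend-*Λ f lin x x′) (*Λ-cong fx≈y fx′≈y′)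
      prod∈ : ∀ ts → InImage (prod (map gen ts))
      prod∈ []       = 1Λ , extend-1Λ f
      prod∈ (t ∷ ts) = *Λ∈ (gen∈ t) (prod∈ ts)
      combination∈ : ∀ Ss → InImage (combination Ss y mono)
      combination∈ []       = 0Λ , extend-0Λ f
      combination∈ (S ∷ Ss) = InImage-+Λ (InImage-·Λ (y S) (InImage-cong (prod-gen-elems S) (prod∈ (elems S)))) (combination∈ Ss)

  monoImage≈mono : ∀ {k} (f : Fin k → Λ k) S → (∀ i → i ∈ S → f i ≡ gen i) → monoImage f S ≈Λ mono S
  monoImage≈mono f S f≡gen = ≈Λ-trans (≈Λ-reflexive (P.cong prod (map-cong-local (elems-All S f≡gen)))) (prod-gen-elems S)

  module _ {k′ : ℕ} where

    extend-∂mono : ∀ {k} (f : Fin k → Λ k′) → (∀ i → Linear (f i)) → (∀ i → ∂ (f i) ≈Λ 1Λ) →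
                   ∀ C → extend f (∂mono C) ≈Λ ∂ (monoImage f C)
    extend-∂mono f lin ∂f≈1 C = begin
      extend f (∂mono C)      ≈⟨ extend-cong f (∂mono≈∂-mono C) ⟩
      extend f (∂ (mono C))   ≈⟨ extend-∂ f lin ∂f≈1 (mono C) ⟨
      ∂ (extend f (mono C))   ≈⟨ ∂-cong (extend-mono f C) ⟩
      ∂ (monoImage f C)       ∎
      where open ≈Λ-Reasoning

    prod-tabulate-cong : ∀ {j} {g g′ : Fin j → Λ k′} → (∀ i → g i ≈Λ g′ i) → prod (tabulate g) ≈Λ prod (tabulate g′)
    prod-tabulate-cong {zero}  g≈g′ = ≈Λ-refl
    prod-tabulate-cong {suc j} g≈g′ = *Λ-cong (g≈g′ zero) (prod-tabulate-cong (g≈g′ ∘ suc))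

    prod-tabulate-snoc : ∀ j (g : Fin (suc j) → Λ k′) → prod (tabulate g) ≈Λ prod (tabulate (g ∘ inject₁)) *Λ g (fromℕ j)
    prod-tabulate-snoc zero    g = ≈Λ-trans (*Λ-identityʳ (g zero)) (≈Λ-sym (*Λ-identityˡ (g zero)))
    prod-tabulate-snoc (suc j) g =
      ≈Λ-trans (*Λ-congʳ (prod-tabulate-snoc j (g ∘ suc))) (≈Λ-sym (*Λ-assoc (g zero) _ (g (fromℕ (suc j)))))

    prod-shift-*Λ : ∀ {q : Λ k′} → Linear q → ∀ {j} (g : Fin j → Λ k′) →
                    prod (tabulate (λ i → g i +Λ q)) *Λ q ≈Λ prod (tabulate g) *Λ q
    prod-shift-*Λ lq {zero}  g = ≈Λ-refl
    prod-shift-*Λ {q} lq {suc j} g = begin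
      ((g zero +Λ q) *Λ P′) *Λ q       ≈⟨ *Λ-assoc _ P′ q ⟩
      (g zero +Λ q) *Λ (P′ *Λ q)       ≈⟨ *Λ-congʳ (prod-shift-*Λ lq (g ∘ suc)) ⟩
      (g zero +Λ q) *Λ (P *Λ q)        ≈⟨ *Λ-distribʳ (P *Λ q) (g zero) q ⟩
      g zero *Λ (P *Λ q) +Λ q *Λ (P *Λ q)
        ≈⟨ +Λ-cong ≈Λ-refl (Linear-*Λ-sandwich lq P) ⟩
      g zero *Λ (P *Λ q) +Λ 0Λ         ≈⟨ (λ U → +-identityʳ _) ⟩
      g zero *Λ (P *Λ q)               ≈⟨ *Λ-assoc (g zero) P q ⟨
      (g zero *Λ P) *Λ q               ∎
      where
      open ≈Λ-Reasoning
      P′ = prod (tabulate ((λ i → g i +Λ q) ∘ suc))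
      P = prod (tabulate (g ∘ suc))

    ∂-prod-closed : ∀ {j} (g : Fin j → Λ k′) → (∀ i → ∂ (g i) ≈Λ 0Λ) → ∂ (prod (tabulate g)) ≈Λ 0Λ
    ∂-prod-closed {zero}  g _     = ∂-1Λ
    ∂-prod-closed {suc j} g ∂g≈0 = begin
      ∂ (g zero *Λ P)                      ≈⟨ ∂-*Λ (g zero) P ⟩
      ∂ (g zero) *Λ P +Λ ι (g zero) *Λ ∂ P ≈⟨ +Λ-cong (≈Λ-trans (*Λ-congˡ (∂g≈0 zero)) (*Λ-zeroˡ P))
                                                      (≈Λ-trans (*Λ-congʳ (∂-prod-closed (g ∘ suc) (∂g≈0 ∘ suc))) (*Λ-zeroʳ _)) ⟩
      0Λ +Λ 0Λ                             ≈⟨ (λ U → +-identityˡ 0#) ⟩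
      0Λ                                   ∎
      where
      open ≈Λ-Reasoning
      P = prod (tabulate (g ∘ suc))

module ParallelConnectionMap {c ℓ} (K : CommutativeRing c ℓ) (n′ m : ℕ) (ε0 : Fin m) where

  open CommutativeRing K hiding (zero) renaming (Carrier to R)
  open import Algebra.Properties.Ring ring using (-‿+-comm; -‿involutive)
  open ExteriorAlgebra K

  n₁ n N : ℕ
  n₁ = suc (suc n′)
  n  = suc n₁
  N  = n ℕ.+ m

  3≤n : 3 ≤ n
  3≤n = s≤s (s≤s (s≤s z≤n))

  f : Fin N → Λ N
  f = φimg 3≤n ε0

  -- ē i is the generator of the class of i + 1 ∈ [n]; in particular ē zero = ē_{ε0}.
  ē : Fin n → Λ N
  ē i = gen (clsN ε0 i)

  ēₙ eₚ : Λ N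
  ēₙ = ē (fromℕ n₁)
  eₚ = gen (zero ↑ˡ m)

  f-↑ʳ : ∀ ε → f (n ↑ʳ ε) ≡ gen (n ↑ʳ ε)
  f-↑ʳ ε rewrite splitAt-↑ʳ n m ε = P.refl

  f-last : f (fromℕ n₁ ↑ˡ m) ≡ eₚ
  f-last rewrite splitAt-↑ˡ n (fromℕ n₁) m with fromℕ n₁ ≟F fromℕ n₁
  ... | yes _ = P.refl
  ... | no ≢  = ⊥-elim (≢ P.refl)

  f-inject₁ : ∀ j → f (inject₁ j ↑ˡ m) ≡ ē (inject₁ j) -Λ ēₙ +Λ eₚ
  f-inject₁ j rewrite splitAt-↑ˡ n (inject₁ j) m with inject₁ j ≟F fromℕ n₁
  ... | yes ≡ = ⊥-elim (fromℕ≢inject₁ (P.sym ≡))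
  ... | no _  = P.refl

  f-Linear : ∀ t → Linear (f t)
  f-Linear t with splitAt n t
  ... | inj₂ ε = Linear-gen (n ↑ʳ ε)
  ... | inj₁ i with i ≟F fromℕ n₁
  ...   | yes _ = Linear-gen (zero ↑ˡ m)
  ...   | no _  = Linear-+Λ (Linear-+Λ (Linear-gen (clsN ε0 i)) (Linear-neg (Linear-gen (clsN ε0 (fromℕ n₁))))) (Linear-gen (zero ↑ˡ m))

  ∂-gen-gen : (s t : Fin N) → ∂ (gen s -Λ gen t) ≈Λ 0Λ
  ∂-gen-gen s t = begin
    ∂ (gen s -Λ gen t)   ≈⟨ ∂-+Λ (gen s) (-Λ gen t) ⟩
    ∂ (gen s) +Λ ∂ (-Λ gen t)
                         ≈⟨ +Λ-cong (∂-gen s) (≈Λ-trans (∂-neg (gen t)) (-Λ-cong (∂-gen t))) ⟩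
    1Λ -Λ 1Λ             ≈⟨ (λ U → -‿inverseʳ _) ⟩
    0Λ                   ∎
    where open ≈Λ-Reasoning

  f-∂ : ∀ t → ∂ (f t) ≈Λ 1Λ
  f-∂ t with splitAt n t
  ... | inj₂ ε = ∂-gen (n ↑ʳ ε)
  ... | inj₁ i with i ≟F fromℕ n₁
  ...   | yes _ = ∂-gen (zero ↑ˡ m)
  ...   | no _  = ≈Λ-trans (∂-+Λ _ eₚ) (≈Λ-trans (+Λ-cong (∂-gen-gen (clsN ε0 i) (clsN ε0 (fromℕ n₁))) (∂-gen (zero ↑ˡ m)))
                                                (λ U → +-identityˡ _))

  Cₙ S₁ T : Subset N
  Cₙ = full {n} ++ ∅ {m}
  S₁ = (false ∷ full {n₁}) ++ ∅ {m}
  T  = (false ∷ full {n₁}) ++ ⁅ ε0 ⁆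

  w : Λ N
  w = prod (tabulate λ j → ē (inject₁ j) -Λ ēₙ)

  ∂w≈0 : ∂ w ≈Λ 0Λ
  ∂w≈0 = ∂-prod-closed (λ j → ē (inject₁ j) -Λ ēₙ) λ j → ∂-gen-gen (clsN ε0 (inject₁ j)) (clsN ε0 (fromℕ n₁))

  f-image-Cₙ : monoImage f Cₙ ≈Λ w *Λ eₚ
  f-image-Cₙ = begin
    monoImage f Cₙ                                           ≡⟨ P.cong (prod ∘ map f) (elems-⊤++∅ n) ⟩
    prod (map f (tabulate (_↑ˡ m)))                          ≡⟨ P.cong prod (map-tabulate (_↑ˡ m) f) ⟩
    prod (tabulate (f ∘ (_↑ˡ m)))                            ≈⟨ prod-tabulate-snoc n₁ (f ∘ (_↑ˡ m)) ⟩
    prod (tabulate (λ j → f (inject₁ j ↑ˡ m))) *Λ f (fromℕ n₁ ↑ˡ m)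
      ≈⟨ *Λ-cong (prod-tabulate-cong (≈Λ-reflexive ∘ f-inject₁)) (≈Λ-reflexive f-last) ⟩
    prod (tabulate (λ j → ē (inject₁ j) -Λ ēₙ +Λ eₚ)) *Λ eₚ
      ≈⟨ prod-shift-*Λ (Linear-gen (zero ↑ˡ m)) (λ j → ē (inject₁ j) -Λ ēₙ) ⟩
    w *Λ eₚ                                                  ∎
    where open ≈Λ-Reasoning

  prod-ē≈w*Λēₙ : prod (tabulate ē) ≈Λ w *Λ ēₙ
  prod-ē≈w*Λēₙ = begin
    prod (tabulate ē)                                        ≈⟨ prod-tabulate-snoc n₁ ē ⟩
    prod (tabulate (ē ∘ inject₁)) *Λ ēₙ                      ≈⟨ *Λ-congˡ (prod-tabulate-cong λ j U → sym (+-cancel-ēₙ j U)) ⟩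
    prod (tabulate (λ j → ē (inject₁ j) -Λ ēₙ +Λ ēₙ)) *Λ ēₙ
      ≈⟨ prod-shift-*Λ (Linear-gen (clsN ε0 (fromℕ n₁))) (λ j → ē (inject₁ j) -Λ ēₙ) ⟩
    w *Λ ēₙ                                                  ∎
    where
    open ≈Λ-Reasoning
    +-cancel-ēₙ : ∀ j → ē (inject₁ j) -Λ ēₙ +Λ ēₙ ≈Λ ē (inject₁ j)
    +-cancel-ēₙ j U = trans (+-assoc _ _ _) (trans (+-cong refl (-‿inverseˡ _)) (+-identityʳ _))

  ⁅ε0⁆∪S₁≡T : ⁅ n ↑ʳ ε0 ⁆ ∪ S₁ ≡ T
  ⁅ε0⁆∪S₁≡T = P.trans (P.cong (_∪ S₁) (⁅↑ʳ⁆ n ε0))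
                (P.trans (∪-++ (∅ {n}) (false ∷ full {n₁}) ⁅ ε0 ⁆ (∅ {m}))
                         (P.cong₂ _++_ (∪-identityˡ (false ∷ full {n₁})) (∪-identityʳ ⁅ ε0 ⁆)))

  ⁅ε0⁆∩S₁≡∅ : disjointᵇ ⁅ n ↑ʳ ε0 ⁆ S₁ ≡ true
  ⁅ε0⁆∩S₁≡∅ = P.trans (P.cong (λ X → disjointᵇ X S₁) (⁅↑ʳ⁆ n ε0))
                (P.trans (disjointᵇ-++ (∅ {n}) (false ∷ full {n₁}) ⁅ ε0 ⁆ (∅ {m}))
                         (P.cong₂ _∧_ (disjointᵇ-∅ˡ (false ∷ full {n₁})) (disjointᵇ-∅ʳ ⁅ ε0 ⁆)))

  sign : R
  sign = sgn (inv ⁅ n ↑ʳ ε0 ⁆ S₁)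

  prod-ē≈mono-T : prod (tabulate ē) ≈Λ sign ·Λ mono T
  prod-ē≈mono-T = begin
    ē zero *Λ prod (tabulate (ē ∘ suc))            ≡⟨ P.cong (λ is → ē zero *Λ prod is) (P.sym elems-S₁) ⟩
    gen (n ↑ʳ ε0) *Λ prod (map gen (elems S₁))     ≈⟨ *Λ-congʳ (prod-gen-elems S₁) ⟩
    mono ⁅ n ↑ʳ ε0 ⁆ *Λ mono S₁                    ≈⟨ mono-*Λ-disjoint ⁅ n ↑ʳ ε0 ⁆ S₁ ⁅ε0⁆∩S₁≡∅ ⟩
    sign ·Λ mono (⁅ n ↑ʳ ε0 ⁆ ∪ S₁)                ≡⟨ P.cong (λ X → sign ·Λ mono X) ⁅ε0⁆∪S₁≡T ⟩
    sign ·Λ mono T                                 ∎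
    where
    open ≈Λ-Reasoning
    elems-S₁ : map gen (elems S₁) ≡ tabulate (ē ∘ suc)
    elems-S₁ = P.trans (P.cong (map gen) (P.trans (P.cong (map suc) (elems-⊤++∅ n₁)) (map-tabulate (_↑ˡ m) suc)))
                       (map-tabulate (suc ∘ (_↑ˡ m)) gen)

  f-∂mono-Cₙ : extend f (∂mono Cₙ) ≈Λ sign ·Λ ∂mono T
  f-∂mono-Cₙ = begin
    extend f (∂mono Cₙ)    ≈⟨ extend-∂mono f f-Linear f-∂ Cₙ ⟩
    ∂ (monoImage f Cₙ)     ≈⟨ ∂-cong f-image-Cₙ ⟩
    ∂ (w *Λ eₚ)            ≈⟨ ∂-*Λ-closed w eₚ ∂w≈0 (∂-gen (zero ↑ˡ m)) ⟩
    ι w                    ≈⟨ ∂-*Λ-closed w ēₙ ∂w≈0 (∂-gen (clsN ε0 (fromℕ n₁))) ⟨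
    ∂ (w *Λ ēₙ)            ≈⟨ ∂-cong (≈Λ-trans (≈Λ-sym prod-ē≈w*Λēₙ) prod-ē≈mono-T) ⟩
    ∂ (sign ·Λ mono T)     ≈⟨ ≈Λ-trans (∂-·Λ sign (mono T)) (·Λ-cong sign (≈Λ-sym (∂mono≈∂-mono T))) ⟩
    sign ·Λ ∂mono T        ∎
    where open ≈Λ-Reasoning

  f-∂mono-E₀ : (D : Subset m) → extend f (∂mono (∅ {n} ++ D)) ≈Λ ∂mono (∅ {n} ++ D)
  f-∂mono-E₀ D = begin
    extend f (∂mono (∅ ++ D))   ≈⟨ extend-∂mono f f-Linear f-∂ (∅ ++ D) ⟩
    ∂ (monoImage f (∅ ++ D))    ≈⟨ ∂-cong (monoImage≈mono f (∅ ++ D) f≡gen) ⟩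
    ∂ (mono (∅ ++ D))           ≈⟨ ∂mono≈∂-mono (∅ ++ D) ⟨
    ∂mono (∅ ++ D)              ∎
    where
    open ≈Λ-Reasoning
    f≡gen : ∀ t → t ∈ ∅ ++ D → f t ≡ gen t
    f≡gen t t∈ with ∈-++⁻ (∅ {n}) t∈
    ... | inj₁ (_ , i∈∅ , _)  = ⊥-elim (∉⊥ i∈∅)
    ... | inj₂ (ε , _ , P.refl) = f-↑ʳ ε

  T-image : ImageOf (clsN ε0) (_∈ full) T
  T-image y = to , from
    where
    to : y ∈ T → ∃ λ i → i ∈ full × clsN ε0 i ≡ y
    to y∈T with ∈-++⁻ (false ∷ full {n₁}) y∈T
    ... | inj₁ (suc i , _ , eq)       = suc i , ∈⊤ , eq
    ... | inj₂ (ε , ε∈⁅ε0⁆ , P.refl) with x∈⁅y⁆⇒x≡y ε0 ε∈⁅ε0⁆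
    ...   | P.refl = zero , ∈⊤ , P.refl
    from : (∃ λ i → i ∈ full × clsN ε0 i ≡ y) → y ∈ T
    from (zero , _ , P.refl)  = ∈-++⁺ʳ (false ∷ full {n₁}) (x∈⁅x⁆ ε0)
    from (suc i , _ , P.refl) = ∈-++⁺ˡ ⁅ ε0 ⁆ (there ∈⊤)

  E₀-image : (D : Subset m) → ImageOf (cls0 {n}) (_∈ D) (∅ {n} ++ D)
  E₀-image D y = to , from
    where
    to : y ∈ ∅ ++ D → ∃ λ ε → ε ∈ D × cls0 {n} ε ≡ y
    to y∈ with ∈-++⁻ (∅ {n}) y∈
    ... | inj₁ (_ , i∈∅ , _) = ⊥-elim (∉⊥ i∈∅)
    ... | inj₂ ε∈D           = ε∈D
    from : (∃ λ ε → ε ∈ D × cls0 {n} ε ≡ y) → y ∈ ∅ ++ D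
    from (ε , ε∈D , P.refl) = ∈-++⁺ʳ (∅ {n}) ε∈D

  f-∂mono-circuit : (M0 : SimpleMatroid m) → ∀ {C} → MCirc {n} M0 C → InIdeal (M'Circ 3≤n M0 ε0) (extend f (∂mono C))
  f-∂mono-circuit M0 (inj₁ (_ , P.refl , P.refl)) =
    resp-mem (≈Λ-sym f-∂mono-Cₙ) (InIdeal-·Λ-∂mono (inj₁ (inj₁ (full , P.refl , T-image))) sign)
  f-∂mono-circuit M0 (inj₂ (D , D-circ , P.refl)) =
    resp-mem (≈Λ-sym (f-∂mono-E₀ D)) (InIdeal-∂mono (inj₁ (inj₂ (inj₁ (D , D-circ , E₀-image D)))))

  ring-recover-ēₙ : ∀ a p l → (a + p) + - ((a + - l) + p) ≈ l
  ring-recover-ēₙ a p l = begin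
    (a + p) + - ((a + - l) + p)
      ≈⟨ +-cong refl (trans (sym (-‿+-comm _ _)) (+-cong (trans (sym (-‿+-comm _ _)) (+-cong refl (-‿involutive l))) refl)) ⟩
    (a + p) + ((- a + l) + - p)
      ≈⟨ +-Solver.solve 5 (λ a p a′ l p′ → ((a ⊕ p) ⊕ ((a′ ⊕ l) ⊕ p′)) ⊜ ((a ⊕ a′) ⊕ (l ⊕ (p ⊕ p′)))) refl a p (- a) l (- p) ⟩
    (a + - a) + (l + (p + - p))   ≈⟨ +-cong (-‿inverseʳ a) (+-cong refl (-‿inverseʳ p)) ⟩
    0# + (l + 0#)                 ≈⟨ trans (+-identityˡ _) (+-identityʳ l) ⟩
    l                             ∎
    where
    open ≈-Reasoning
    open +-Solver using (_⊕_; _⊜_)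

  ring-recover-ē : ∀ a l p → (((a + - l) + p) + l) + - p ≈ a
  ring-recover-ē a l p = begin
    (((a + - l) + p) + l) + - p
      ≈⟨ +-Solver.solve 5 (λ a l′ p l p′ → ((((a ⊕ l′) ⊕ p) ⊕ l) ⊕ p′) ⊜ (a ⊕ ((l ⊕ l′) ⊕ (p ⊕ p′)))) refl a (- l) p l (- p) ⟩
    a + ((l + - l) + (p + - p))   ≈⟨ +-cong refl (trans (+-cong (-‿inverseʳ l) (-‿inverseʳ p)) (+-identityˡ 0#)) ⟩
    a + 0#                        ≈⟨ +-identityʳ a ⟩
    a                             ∎
    where
    open ≈-Reasoning
    open +-Solver using (_⊕_; _⊜_)

  eₚ∈ : InImage f eₚ
  eₚ∈ = InImage-cong f (≈Λ-reflexive f-last) (InImage-f f (fromℕ n₁ ↑ˡ m))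

  ē₁∈ : InImage f (ē zero)
  ē₁∈ = InImage-cong f (≈Λ-reflexive (f-↑ʳ ε0)) (InImage-f f (n ↑ʳ ε0))

  ēₙ∈ : InImage f ēₙ
  ēₙ∈ = InImage-cong f (λ U → trans (+-cong refl (-‿cong (reflexive (P.cong (λ z → z U) (f-inject₁ zero)))))
                                     (ring-recover-ēₙ _ _ _))
                     (InImage-+Λ f (InImage-+Λ f ē₁∈ eₚ∈) (InImage-neg f (InImage-f f (zero ↑ˡ m))))

  InImage-ē : ∀ i → InImage f (ē i)
  InImage-ē i with inject₁-or-fromℕ i
  ... | inj₂ P.refl       = ēₙ∈
  ... | inj₁ (j , P.refl) =
    InImage-cong f (λ U → trans (+-cong (+-cong (reflexive (P.cong (λ z → z U) (f-inject₁ j))) refl) refl) (ring-recover-ē _ _ _))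
                 (InImage-+Λ f (InImage-+Λ f (InImage-f f (inject₁ j ↑ˡ m)) ēₙ∈) (InImage-neg f eₚ∈))

  InImage-gen : ∀ t → InImage f (gen t)
  InImage-gen t with ↑ˡ-or-↑ʳ n t
  ... | inj₂ (ε , P.refl)     = InImage-cong f (≈Λ-reflexive (f-↑ʳ ε)) (InImage-f f (n ↑ʳ ε))
  ... | inj₁ (zero , P.refl)  = InImage-cong f (≈Λ-reflexive f-last) (InImage-f f (fromℕ n₁ ↑ˡ m))
  ... | inj₁ (suc i , P.refl) = InImage-ē (suc i)

corollary3p5 : ∀ {c ℓ : Level} (K : CommutativeRing c ℓ) (n m : ℕ) (h : 3 ≤ n)
                 (M0 : SimpleMatroid m) (ε0 : Fin m) →
               let open Ext K
                   φ = φ̂ h ε0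
                   IM = InIdeal (MCirc {n} M0)
                   IM' = InIdeal (M'Circ h M0 ε0)
               in
               -- φ̂ is a K-algebra homomorphism Λ(E) → Λ(Ē ∪ {p})
               (∀ x y → φ (x +Λ y) ≈Λ (φ x +Λ φ y))
               × (∀ r x → φ (r ·Λ x) ≈Λ (r ·Λ φ x))
               × (∀ x y → φ (x *Λ y) ≈Λ (φ x *Λ φ y))
               × (φ 1Λ ≈Λ 1Λ)
               -- φ̂ (I(M)) ⊆ I(M'), so φ̂ induces φ : A(M) → A(M')
               × (∀ x → IM x → IM' (φ x))
               -- φ is graded (preserves degree)
               × (∀ d x → Homog d x → Homog d (φ x))
               -- φ is surjective: every y is φ̂ x modulo I(M')
               × (∀ y → ∃ λ x → IM' (y -Λ φ x))
corollary3p5 K (suc (suc (suc n′))) m (s≤s (s≤s (s≤s z≤n))) M0 ε0 =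
    extend-+Λ f , extend-·Λ f , extend-*Λ f f-Linear , extend-1Λ f
  , (λ x → extend-InIdeal f f-Linear (f-∂mono-circuit M0))
  , extend-Homog f f-Linear
  , λ y → let (x , fx≈y) = extend-surjective f f-Linear InImage-gen y in x , ≈Λ⇒InIdeal-difference fx≈y
  where
  open ExteriorAlgebra K
  open ParallelConnectionMap K n′ m ε0
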